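{- Let $m\ge 2$ and $h\ge 1$, and let $T(m,h)$ be the complete $m$-ary tree of height $h$, with $n=\frac{m^{h+1}-1}{m-1}$ vertices. In the two-player safe game of Competitive Diffusion on $T(m,h)$, the safety value of Player 1 is $$\mathrm{value}(A_{T(m,h)})=\frac{(n-1)((m-1)n+1)}{n(m^2-m+1)+m-1}.$$ Moreover, the strategy $\mu_1$ is a maxmin strategy for Player 1 (its guaranteed gain $\min_{Y}\mu_1 A Y^T$ equals this value) and the strategy $\mu_2$ is a minmax strategy for Player 2 (Player 1's maximal gain $\max_X X A\mu_2^T$ against it equals this value), where, with $D=m^{h+2}-m^{h+1}+m^h-1$: $\mu_1$ assigns probability $\frac{m^h-1}{D}$ to the root, $\frac{(m-1)m^h}{D}$ to each vertex of depth $1$, and $0$ to all vertices of depth $\ge 2$; $\mu_2$ assigns probability $\frac{(m-1)(m^{h+1}-m^h+1)}{D}$ to the root, $\frac{m^h-1}{D}$ to each vertex of depth $1$, and $0$ to all vertices of depth $\ge 2$.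
   Context: Competitive Diffusion (two players) on a finite graph $G$: Player 1 chooses a starting vertex $a$ and Player 2 a starting vertex $b$, each player having a distinct colour. If $a=b$, that vertex turns grey and both gain $0$. Otherwise $a$ gets Player 1's colour and $b$ Player 2's, and diffusion proceeds in rounds: an uncoloured vertex all of whose player-coloured neighbours have the same colour inherits that colour, while an uncoloured vertex with neighbours of both player colours turns grey (grey vertices do not spread); this continues until no change. Player 1's gain is the number of vertices of her colour. With $V(G)=\{v_1,\dots,v_n\}$, $A_G$ is the matrix whose $(i,j)$ entry is Player 1's gain when she starts at $v_i$ and Player 2 at $v_j$. Mixed strategies are probability vectors $X,Y$ on $V(G)$, the expected gain of Player 1 is $XA_GY^T$, and the safety value is $\max_X\min_Y XA_GY^T=\min_Y\max_X XA_GY^T$. A complete $m$-ary tree of height $h$ is a rooted tree in which every internal vertex has exactly $m$ children and all leaves have depth $h$.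
   Formalization: The mixed strategies X and Y against which μ₁ and μ₂ are tested are probability vectors with rational entries. -}

module Defs where

open import Data.Nat as ℕ using (ℕ; zero; suc; _∸_; _^_; _≡ᵇ_; _≤ᵇ_)
import Data.Nat.DivMod as ℕDM
open import Data.Bool using (Bool; true; false; _∧_; _∨_; not; if_then_else_)
open import Data.Fin using (Fin; toℕ)
open import Data.Integer using (+_)
open import Data.Rational using (ℚ; 0ℚ; 1ℚ; _+_; _*_; _≤_; _/_)
open import Data.Product using (_×_)
open import Relation.Binary.PropositionalEquality using (_≡_)

record Graph : Set where
  field
    size : ℕ
    adj  : Fin size → Fin size → Bool
open Graph public

data Colour : Set where
  uncol p1 p2 grey : Colour

isP1 isP2 isUncol : Colour → Bool
isP1 p1 = true
isP1 _  = false
isP2 p2 = true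
isP2 _  = false
isUncol uncol = true
isUncol _     = false

anyFin : ∀ {n} → (Fin n → Bool) → Bool
anyFin {zero}  f = false
anyFin {suc n} f = f Data.Fin.zero ∨ anyFin (λ i → f (Data.Fin.suc i))

step : (G : Graph) → (Fin (size G) → Colour) → Fin (size G) → Colour
step G c v with isUncol (c v)
... | false = c v
... | true with anyFin (λ u → adj G v u ∧ isP1 (c u))
               | anyFin (λ u → adj G v u ∧ isP2 (c u))
...   | true  | true  = grey
...   | true  | false = p1
...   | false | true  = p2
...   | false | false = uncol

iterate : ∀ {A : Set} → ℕ → (A → A) → A → A
iterate zero    f x = x
iterate (suc k) f x = iterate k f (f x)

initial : (G : Graph) → Fin (size G) → Fin (size G) → Fin (size G) → Colour
initial G a b v =
  if toℕ a ≡ᵇ toℕ b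
  then (if toℕ v ≡ᵇ toℕ a then grey else uncol)
  else (if toℕ v ≡ᵇ toℕ a then p1 else (if toℕ v ≡ᵇ toℕ b then p2 else uncol))

-- Final colouring: every round that changes something colours at least
-- one new vertex, so after (size G) rounds no further change happens.
final : (G : Graph) → Fin (size G) → Fin (size G) → Fin (size G) → Colour
final G a b = iterate (size G) (step G) (initial G a b)

countFin : ∀ {n} → (Fin n → Bool) → ℕ
countFin {zero}  f = 0
countFin {suc n} f = (if f Data.Fin.zero then 1 else 0) ℕ.+ countFin (λ i → f (Data.Fin.suc i))

gainMatrix : (G : Graph) → Fin (size G) → Fin (size G) → ℕ
gainMatrix G a b = countFin (λ v → isP1 (final G a b v))

ΣFin : ∀ {n} → (Fin n → ℚ) → ℚ
ΣFin {zero}  f = 0ℚ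
ΣFin {suc n} f = f Data.Fin.zero + ΣFin (λ i → f (Data.Fin.suc i))

IsMixed : ∀ {n} → (Fin n → ℚ) → Set
IsMixed {n} X = (∀ i → 0ℚ ≤ X i) × ΣFin X ≡ 1ℚ

expGain : (G : Graph) → (Fin (size G) → ℚ) → (Fin (size G) → ℚ) → ℚ
expGain G X Y =
  ΣFin (λ i → ΣFin (λ j → X i * ((+ gainMatrix G i j / 1) * Y j)))

-- Total division helpers (denominators are positive wherever used).

divℕ : ℕ → ℕ → ℕ
divℕ a zero    = 0
divℕ a (suc k) = ℕDM._/_ a (suc k)

frac : ℕ → ℕ → ℚ
frac a zero    = 0ℚ
frac a (suc d) = + a / suc d

-- Complete m-ary tree of height h, vertices numbered in BFS (heap)
-- order: vertex 0 is the root, the parent of vertex i ≥ 1 is ⌊(i-1)/m⌋.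

treeSize : ℕ → ℕ → ℕ
treeSize m zero    = 1
treeSize m (suc h) = treeSize m h ℕ.+ m ^ suc h

parent : ℕ → ℕ → ℕ
parent m i = divℕ (i ∸ 1) m

isParentOf : ℕ → ℕ → ℕ → Bool
isParentOf m i j = not (j ≡ᵇ 0) ∧ (parent m j ≡ᵇ i)

T : ℕ → ℕ → Graph
T m h = record
  { size = treeSize m h
  ; adj  = λ i j → isParentOf m (toℕ i) (toℕ j) ∨ isParentOf m (toℕ j) (toℕ i)
  }

-- depth of vertex i (fuel i suffices since parent m i < i for i ≥ 1, m ≥ 1)
depthF : ℕ → ℕ → ℕ → ℕ
depthF m zero     i = 0
depthF m (suc f)  i = if i ≡ᵇ 0 then 0 else suc (depthF m f (parent m i))

depth : ℕ → ℕ → ℕ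
depth m i = depthF m i i

Dval : ℕ → ℕ → ℕ
Dval m h = ((m ^ (h ℕ.+ 2) ∸ m ^ (h ℕ.+ 1)) ℕ.+ m ^ h) ∸ 1

byDepth : (m h : ℕ) → ℚ → ℚ → Fin (treeSize m h) → ℚ
byDepth m h r d1 v with depth m (toℕ v)
... | 0     = r
... | 1     = d1
... | suc (suc _) = 0ℚ

μ₁ : (m h : ℕ) → Fin (treeSize m h) → ℚ
μ₁ m h = byDepth m h (frac (m ^ h ∸ 1) (Dval m h))
                     (frac ((m ∸ 1) ℕ.* m ^ h) (Dval m h))

μ₂ : (m h : ℕ) → Fin (treeSize m h) → ℚ
μ₂ m h = byDepth m h (frac ((m ∸ 1) ℕ.* ((m ^ (h ℕ.+ 1) ∸ m ^ h) ℕ.+ 1)) (Dval m h))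
                     (frac (m ^ h ∸ 1) (Dval m h))

valueFormula : ℕ → ℕ → ℚ
valueFormula m h =
  frac ((n ∸ 1) ℕ.* ((m ∸ 1) ℕ.* n ℕ.+ 1))
       ((n ℕ.* ((m ℕ.* m ∸ m) ℕ.+ 1) ℕ.+ m) ∸ 1)
  where n = treeSize m h

-- Both bounds are checked against one pure strategy of the opponent at a time: each column
-- of the gain matrix weighted by μ₁ and each row weighted by μ₂ is compared with the value.
-- As μ₁ and μ₂ live on the root and the depth-1 vertices, the gains involved all follow from
-- one property of diffusion on a tree: a colour can leave a subtree only through the
-- subtree's root.  Hence a player whose opponent stands on, or next to, the parent of a
-- subtree stays inside it, and a player on the root of a subtree the opponent is outside of
-- takes the whole subtree.  With s the size of a subtree hanging from a depth-1 vertex, the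
-- column and row bounds become polynomial identities in m - 1 and s.
module Submission where

import Data.Nat
import Data.Fin
import Defs


module FiniteSums where

  open import Data.Nat using (ℕ; zero; suc; _+_; _≤_; _<_; _⊓_; _<ᵇ_; _≤ᵇ_; z≤n)
  open import Data.Nat.Properties
  open import Data.Bool using (Bool; true; false; _∧_; _∨_; not; if_then_else_; T)
  open import Data.Fin using (Fin; toℕ)
  import Data.Fin as F
  open import Data.Fin.Properties using (toℕ<n)
  open import Data.Empty using (⊥; ⊥-elim)
  open import Data.Unit using (tt)
  open import Relation.Binary.PropositionalEquality
  open import Relation.Nullary using (¬_)
  open import Data.Bool.Properties using (T-≡)
  open import Function.Bundles using (Equivalence)
  open import Defs using (countFin)
  open import Algebra.Properties.Semiring.Sum +-*-semiring public
    using (sum; sum-cong-≗; ∑-distrib-+; *-distribˡ-sum)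

  indicator : Bool → ℕ
  indicator b = if b then 1 else 0

  count : ∀ {n} → (Fin n → Bool) → ℕ
  count f = sum (λ i → indicator (f i))

  countFin≡count : ∀ {n} (f : Fin n → Bool) → countFin f ≡ count f
  countFin≡count {zero} f = refl
  countFin≡count {suc n} f = cong (indicator (f F.zero) +_) (countFin≡count (λ i → f (F.suc i)))

  sum-mono-≤ : ∀ {n} {f g : Fin n → ℕ} → (∀ i → f i ≤ g i) → sum f ≤ sum g
  sum-mono-≤ {zero} f≤g = z≤n
  sum-mono-≤ {suc n} f≤g = +-mono-≤ (f≤g F.zero) (sum-mono-≤ (λ i → f≤g (F.suc i)))

  sum-zero : ∀ {n} {f : Fin n → ℕ} → (∀ i → f i ≡ 0) → sum f ≡ 0
  sum-zero {zero} f≡0 = refl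
  sum-zero {suc n} f≡0 = cong₂ _+_ (f≡0 F.zero) (sum-zero (λ i → f≡0 (F.suc i)))

  count-false : ∀ {n} → count {n} (λ _ → false) ≡ 0
  count-false {n} = sum-zero {n} (λ _ → refl)

  count-not : ∀ {n} (f : Fin n → Bool) → count (λ i → not (f i)) + count f ≡ n
  count-not {zero} f = refl
  count-not {suc n} f with f F.zero
  ... | true = trans (+-suc (count (λ i → not (f (F.suc i)))) _) (cong suc (count-not (λ i → f (F.suc i))))
  ... | false = cong suc (count-not (λ i → f (F.suc i)))

  ¬T⇒≡false : ∀ {x} → ¬ T x → x ≡ false
  ¬T⇒≡false {false} _ = refl
  ¬T⇒≡false {true} ¬t = ⊥-elim (¬t tt)

  ¬T⇒T-not : ∀ {x} → ¬ T x → T (not x)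
  ¬T⇒T-not {false} _ = tt
  ¬T⇒T-not {true} ¬t = ¬t tt

  T-not⇒¬T : ∀ {x} → T (not x) → ¬ T x
  T-not⇒¬T {false} _ ()

  ¬T-not⇒T : ∀ {x} → ¬ T (not x) → T x
  ¬T-not⇒T {true} _ = tt
  ¬T-not⇒T {false} ¬t = ⊥-elim (¬t tt)

  indicator-mono : ∀ {x y} → (T x → T y) → indicator x ≤ indicator y
  indicator-mono {false} _ = z≤n
  indicator-mono {true} {true} _ = ≤-refl
  indicator-mono {true} {false} x⇒y = ⊥-elim (x⇒y tt)

  indicator-∨ : ∀ a b → (T a → T b → ⊥) → indicator (a ∨ b) ≡ indicator a + indicator b
  indicator-∨ false b _ = refl
  indicator-∨ true false _ = refl
  indicator-∨ true true disjoint = ⊥-elim (disjoint tt tt)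

  count-< : ∀ n k → count {n} (λ i → toℕ i <ᵇ k) ≡ k ⊓ n
  count-< zero k = sym (⊓-zeroʳ k)
  count-< (suc n) zero = sum-zero {suc n} (λ _ → refl)
  count-< (suc n) (suc k) = cong suc (count-< n k)

  inRange : ℕ → ℕ → ℕ → Bool
  inRange lo hi v = (lo ≤ᵇ v) ∧ (v <ᵇ hi)

  indicator-<-split : ∀ lo hi v → lo ≤ hi →
    indicator (v <ᵇ hi) ≡ indicator (inRange lo hi v) + indicator (v <ᵇ lo)
  indicator-<-split lo hi v lo≤hi with v <ᵇ lo in v<lo | lo ≤ᵇ v in lo≤v | v <ᵇ hi in v<hi
  ... | true  | true  | _     = ⊥-elim (<⇒≱ (<ᵇ⇒< v lo (subst T (sym v<lo) tt)) (≤ᵇ⇒≤ lo v (subst T (sym lo≤v) tt)))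
  ... | true  | false | true  = refl
  ... | true  | false | false = ⊥-elim (subst T v<hi (<⇒<ᵇ (<-≤-trans (<ᵇ⇒< v lo (subst T (sym v<lo) tt)) lo≤hi)))
  ... | false | true  | true  = refl
  ... | false | true  | false = refl
  ... | false | false | _     = ⊥-elim (subst T v<lo (<⇒<ᵇ {v} {lo} (≰⇒> (λ lo≤v' → subst T lo≤v (≤⇒≤ᵇ lo≤v')))))

  indicator-inRange-inside : ∀ lo hi v → lo ≤ v → v < hi → indicator (inRange lo hi v) ≡ 1
  indicator-inRange-inside lo hi v lo≤v v<hi
    rewrite Equivalence.to T-≡ (≤⇒≤ᵇ lo≤v) | Equivalence.to T-≡ (<⇒<ᵇ v<hi) = refl

  indicator-inRange-below : ∀ lo hi v → v < lo → indicator (inRange lo hi v) ≡ 0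
  indicator-inRange-below lo hi v v<lo with lo ≤ᵇ v in lo≤v
  ... | true = ⊥-elim (<⇒≱ v<lo (≤ᵇ⇒≤ lo v (subst T (sym lo≤v) tt)))
  ... | false = refl

  indicator-inRange-above : ∀ lo hi v → hi ≤ v → indicator (inRange lo hi v) ≡ 0
  indicator-inRange-above lo hi v hi≤v with lo ≤ᵇ v | v <ᵇ hi in v<hi
  ... | false | _ = refl
  ... | true | false = refl
  ... | true | true = ⊥-elim (<⇒≱ (<ᵇ⇒< v hi (subst T (sym v<hi) tt)) hi≤v)

  count-inRange : ∀ n lo hi → lo ≤ hi → count {n} (λ i → inRange lo hi (toℕ i)) + lo ⊓ n ≡ hi ⊓ n
  count-inRange n lo hi lo≤hi = begin
    count {n} (λ i → inRange lo hi (toℕ i)) + lo ⊓ n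
      ≡⟨ cong (count {n} (λ i → inRange lo hi (toℕ i)) +_) (sym (count-< n lo)) ⟩
    count {n} (λ i → inRange lo hi (toℕ i)) + count {n} (λ i → toℕ i <ᵇ lo)
      ≡⟨ sym (∑-distrib-+ {n} (λ i → indicator (inRange lo hi (toℕ i))) (λ i → indicator (toℕ i <ᵇ lo))) ⟩
    sum {n} (λ i → indicator (inRange lo hi (toℕ i)) + indicator (toℕ i <ᵇ lo))
      ≡⟨ sum-cong-≗ {n} (λ i → sym (indicator-<-split lo hi (toℕ i) lo≤hi)) ⟩
    count {n} (λ i → toℕ i <ᵇ hi)
      ≡⟨ count-< n hi ⟩
    hi ⊓ n ∎
    where open ≡-Reasoning

  count-inRange-inside : ∀ n lo len → lo + len ≤ n → count {n} (λ i → inRange lo (lo + len) (toℕ i)) ≡ len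
  count-inRange-inside n lo len lo+len≤n = +-cancelʳ-≡ lo _ _ (begin
    count {n} (λ i → inRange lo (lo + len) (toℕ i)) + lo
      ≡⟨ cong (count {n} (λ i → inRange lo (lo + len) (toℕ i)) +_) (sym (m≤n⇒m⊓n≡m (m+n≤o⇒m≤o lo lo+len≤n))) ⟩
    count {n} (λ i → inRange lo (lo + len) (toℕ i)) + lo ⊓ n
      ≡⟨ count-inRange n lo (lo + len) (m≤m+n lo len) ⟩
    (lo + len) ⊓ n
      ≡⟨ m≤n⇒m⊓n≡m lo+len≤n ⟩
    lo + len
      ≡⟨ +-comm lo len ⟩
    len + lo ∎)
    where open ≡-Reasoning

  count-inRange-≤ : ∀ n lo len → count {n} (λ i → inRange lo (lo + len) (toℕ i)) ≤ len
  count-inRange-≤ n lo len = +-cancelʳ-≤ (lo ⊓ n) _ _ (begin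
    count {n} (λ i → inRange lo (lo + len) (toℕ i)) + lo ⊓ n
      ≡⟨ count-inRange n lo (lo + len) (m≤m+n lo len) ⟩
    (lo + len) ⊓ n
      ≤⟨ ⊓-mono-≤ (≤-reflexive (+-comm lo len)) (m≤n+m n len) ⟩
    (len + lo) ⊓ (len + n)
      ≡⟨ sym (+-distribˡ-⊓ len lo n) ⟩
    len + lo ⊓ n ∎)
    where open ≤-Reasoning

  count-inRange-beyond : ∀ n lo hi → n ≤ lo → count {n} (λ i → inRange lo hi (toℕ i)) ≡ 0
  count-inRange-beyond n lo hi n≤lo = sum-zero {n} (λ i → indicator-inRange-below lo hi (toℕ i) (<-≤-trans (toℕ<n i) n≤lo))


module Fractions where

  open import Data.Nat as ℕ using (ℕ; suc)
  import Data.Nat.Properties as ℕP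
  open import Data.Integer as ℤ using (+_)
  import Data.Integer.Properties as ℤP
  open import Data.Rational using (ℚ; 0ℚ; 1ℚ; _+_; _*_; _≤_; _/_; toℚᵘ)
  import Data.Rational.Properties as ℚP
  open import Data.Rational.Unnormalised as ℚᵘ using (ℚᵘ; mkℚᵘ; *≡*; *≤*)
  import Data.Rational.Unnormalised.Properties as ℚᵘP
  open import Relation.Binary.PropositionalEquality

  infix 8 _/1+_

  _/1+_ : ℕ → ℕ → ℚ
  a /1+ d = + a / suc d

  fromℕ : ℕ → ℚ
  fromℕ a = + a / 1

  private
    toℚᵘ-/1+ : ∀ a d → toℚᵘ (a /1+ d) ℚᵘ.≃ mkℚᵘ (+ a) d
    toℚᵘ-/1+ a d = ℚP.toℚᵘ-fromℚᵘ (mkℚᵘ (+ a) d)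

    ≡-viaℚᵘ : ∀ {p q : ℚ} {p′ q′ : ℚᵘ} → toℚᵘ p ℚᵘ.≃ p′ → toℚᵘ q ℚᵘ.≃ q′ → p′ ℚᵘ.≃ q′ → p ≡ q
    ≡-viaℚᵘ p≃ q≃ p′≃q′ = ℚP.toℚᵘ-injective (ℚᵘP.≃-trans p≃ (ℚᵘP.≃-trans p′≃q′ (ℚᵘP.≃-sym q≃)))

  /1+-≤ : ∀ a d c e → a ℕ.* suc e ℕ.≤ c ℕ.* suc d → a /1+ d ≤ c /1+ e
  /1+-≤ a d c e le = ℚP.toℚᵘ-cancel-≤
    (ℚᵘP.≤-respˡ-≃ (ℚᵘP.≃-sym (toℚᵘ-/1+ a d)) (ℚᵘP.≤-respʳ-≃ (ℚᵘP.≃-sym (toℚᵘ-/1+ c e))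
      (*≤* (subst₂ ℤ._≤_ (ℤP.pos-* a (suc e)) (ℤP.pos-* c (suc d)) (ℤ.+≤+ le)))))

  0≤/1+ : ∀ a d → 0ℚ ≤ a /1+ d
  0≤/1+ a d = /1+-≤ 0 0 a d ℕ.z≤n

  /1+-self : ∀ d → suc d /1+ d ≡ 1ℚ
  /1+-self d = ≡-viaℚᵘ (toℚᵘ-/1+ (suc d) d) (toℚᵘ-/1+ 1 0)
    (*≡* (trans (ℤP.*-identityʳ (+ suc d)) (sym (ℤP.*-identityˡ (+ suc d)))))

  0/1+ : ∀ d → 0 /1+ d ≡ 0ℚ
  0/1+ d = ≡-viaℚᵘ (toℚᵘ-/1+ 0 d) (toℚᵘ-/1+ 0 0) (*≡* refl)

  fromℕ-+ : ∀ a b → fromℕ (a ℕ.+ b) ≡ fromℕ a + fromℕ b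
  fromℕ-+ a b = ≡-viaℚᵘ (toℚᵘ-/1+ (a ℕ.+ b) 0)
    (ℚᵘP.≃-trans (ℚP.toℚᵘ-homo-+ (fromℕ a) (fromℕ b)) (ℚᵘP.+-cong (toℚᵘ-/1+ a 0) (toℚᵘ-/1+ b 0)))
    (*≡* (begin
       + (a ℕ.+ b) ℤ.* + 1                     ≡⟨ ℤP.*-identityʳ _ ⟩
       + (a ℕ.+ b)                             ≡⟨ ℤP.pos-+ a b ⟩
       + a ℤ.+ + b                             ≡⟨ sym (cong₂ ℤ._+_ (ℤP.*-identityʳ (+ a)) (ℤP.*-identityʳ (+ b))) ⟩
       + a ℤ.* + 1 ℤ.+ + b ℤ.* + 1             ≡⟨ sym (ℤP.*-identityʳ _) ⟩
       (+ a ℤ.* + 1 ℤ.+ + b ℤ.* + 1) ℤ.* + 1   ∎))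
    where open ≡-Reasoning

  fromℕ-* : ∀ a b → fromℕ (a ℕ.* b) ≡ fromℕ a * fromℕ b
  fromℕ-* a b = ≡-viaℚᵘ (toℚᵘ-/1+ (a ℕ.* b) 0)
    (ℚᵘP.≃-trans (ℚP.toℚᵘ-homo-* (fromℕ a) (fromℕ b)) (ℚᵘP.*-cong (toℚᵘ-/1+ a 0) (toℚᵘ-/1+ b 0)))
    (*≡* (cong (ℤ._* + 1) (ℤP.pos-* a b)))

  /1+-split : ∀ a d → a /1+ d ≡ fromℕ a * 1 /1+ d
  /1+-split a d = ≡-viaℚᵘ (toℚᵘ-/1+ a d)
    (ℚᵘP.≃-trans (ℚP.toℚᵘ-homo-* (fromℕ a) (1 /1+ d)) (ℚᵘP.*-cong (toℚᵘ-/1+ a 0) (toℚᵘ-/1+ 1 d)))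
    (*≡* (begin
       + a ℤ.* + suc (d ℕ.+ 0)      ≡⟨ cong (λ x → + a ℤ.* + suc x) (ℕP.+-identityʳ d) ⟩
       + a ℤ.* + suc d              ≡⟨ cong (ℤ._* + suc d) (sym (ℤP.*-identityʳ (+ a))) ⟩
       (+ a ℤ.* + 1) ℤ.* + suc d    ∎))
    where open ≡-Reasoning

  /1+-*-fromℕ : ∀ a b d → a /1+ d * fromℕ b ≡ (a ℕ.* b) /1+ d
  /1+-*-fromℕ a b d = begin
    a /1+ d * fromℕ b                ≡⟨ cong (_* fromℕ b) (/1+-split a d) ⟩
    fromℕ a * 1 /1+ d * fromℕ b      ≡⟨ ℚP.*-assoc (fromℕ a) (1 /1+ d) (fromℕ b) ⟩
    fromℕ a * (1 /1+ d * fromℕ b)    ≡⟨ cong (fromℕ a *_) (ℚP.*-comm (1 /1+ d) (fromℕ b)) ⟩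
    fromℕ a * (fromℕ b * 1 /1+ d)    ≡⟨ sym (ℚP.*-assoc (fromℕ a) (fromℕ b) (1 /1+ d)) ⟩
    fromℕ a * fromℕ b * 1 /1+ d      ≡⟨ cong (_* 1 /1+ d) (sym (fromℕ-* a b)) ⟩
    fromℕ (a ℕ.* b) * 1 /1+ d        ≡⟨ sym (/1+-split (a ℕ.* b) d) ⟩
    (a ℕ.* b) /1+ d                  ∎
    where open ≡-Reasoning


module MixedStrategies where

  open import Data.Nat as ℕ using (ℕ; zero; suc)
  open import Data.Fin using (Fin)
  import Data.Fin as F
  open import Data.Rational using (ℚ; 1ℚ; _+_; _*_; _≤_; nonNegative)
  import Data.Rational.Properties as ℚP
  open import Data.Product using (_,_)
  open import Algebra.Bundles using (CommutativeRing)
  import Algebra.Properties.Semiring.Sum as SemiringSum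
  open import Relation.Binary.PropositionalEquality
  open import Defs using (ΣFin; IsMixed)
  open Fractions
  open FiniteSums using () renaming (sum to ∑ℕ)
  import Data.Nat.Properties as ℕP

  module ℚΣ = SemiringSum (CommutativeRing.semiring ℚP.+-*-commutativeRing)
  open ℚΣ using (sum; sum-cong-≗; ∑-comm; *-distribˡ-sum; *-distribʳ-sum)

  ΣFin≡sum : ∀ {n} (f : Fin n → ℚ) → ΣFin f ≡ sum f
  ΣFin≡sum {zero} f = refl
  ΣFin≡sum {suc n} f = cong (f F.zero +_) (ΣFin≡sum (λ i → f (F.suc i)))

  ΣFin²≡sum² : ∀ {n} (f : Fin n → Fin n → ℚ) → ΣFin (λ i → ΣFin (f i)) ≡ sum (λ i → sum (f i))
  ΣFin²≡sum² {n} f = trans (ΣFin≡sum (λ i → ΣFin (f i))) (sum-cong-≗ {n} (λ i → ΣFin≡sum (f i)))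

  sum-mono-≤ : ∀ {n} {f g : Fin n → ℚ} → (∀ i → f i ≤ g i) → sum f ≤ sum g
  sum-mono-≤ {zero} f≤g = ℚP.≤-refl
  sum-mono-≤ {suc n} f≤g = ℚP.+-mono-≤ (f≤g F.zero) (sum-mono-≤ (λ i → f≤g (F.suc i)))

  sum-fromℕ : ∀ {n} (f : Fin n → ℕ) → sum (λ i → fromℕ (f i)) ≡ fromℕ (∑ℕ f)
  sum-fromℕ {zero} f = refl
  sum-fromℕ {suc n} f =
    trans (cong (fromℕ (f F.zero) +_) (sum-fromℕ (λ i → f (F.suc i)))) (sym (fromℕ-+ (f F.zero) _))

  sum-/1+ : ∀ {n} (w : Fin n → ℕ) d → sum (λ i → w i /1+ d) ≡ ∑ℕ w /1+ d
  sum-/1+ {n} w d = begin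
    sum (λ i → w i /1+ d)                ≡⟨ sum-cong-≗ {n} (λ i → /1+-split (w i) d) ⟩
    sum (λ i → fromℕ (w i) * 1 /1+ d)    ≡⟨ sym (*-distribʳ-sum (1 /1+ d) (λ i → fromℕ (w i))) ⟩
    sum (λ i → fromℕ (w i)) * 1 /1+ d    ≡⟨ cong (_* 1 /1+ d) (sum-fromℕ w) ⟩
    fromℕ (∑ℕ w) * 1 /1+ d               ≡⟨ sym (/1+-split (∑ℕ w) d) ⟩
    ∑ℕ w /1+ d                           ∎
    where open ≡-Reasoning

  sum-/1+-*-fromℕ : ∀ {n} (w a : Fin n → ℕ) d →
    sum (λ i → w i /1+ d * fromℕ (a i)) ≡ ∑ℕ (λ i → w i ℕ.* a i) /1+ d
  sum-/1+-*-fromℕ {n} w a d =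
    trans (sum-cong-≗ {n} (λ i → /1+-*-fromℕ (w i) (a i) d)) (sum-/1+ (λ i → w i ℕ.* a i) d)

  sum-fromℕ-*-/1+ : ∀ {n} (a w : Fin n → ℕ) d →
    sum (λ i → fromℕ (a i) * w i /1+ d) ≡ ∑ℕ (λ i → a i ℕ.* w i) /1+ d
  sum-fromℕ-*-/1+ {n} a w d = begin
    sum (λ i → fromℕ (a i) * w i /1+ d)  ≡⟨ sum-cong-≗ {n} (λ i → ℚP.*-comm (fromℕ (a i)) (w i /1+ d)) ⟩
    sum (λ i → w i /1+ d * fromℕ (a i))  ≡⟨ sum-/1+-*-fromℕ w a d ⟩
    ∑ℕ (λ i → w i ℕ.* a i) /1+ d         ≡⟨ cong (_/1+ d) (FiniteSums.sum-cong-≗ {n} (λ i → ℕP.*-comm (w i) (a i))) ⟩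
    ∑ℕ (λ i → a i ℕ.* w i) /1+ d         ∎
    where open ≡-Reasoning

  gain-≥-byColumns : ∀ {n} (X Y : Fin n → ℚ) (A : Fin n → Fin n → ℕ) v →
    (∀ j → v ≤ sum (λ i → X i * fromℕ (A i j))) → IsMixed Y →
    v ≤ ΣFin (λ i → ΣFin (λ j → X i * (fromℕ (A i j) * Y j)))
  gain-≥-byColumns {n} X Y A v columns (Y≥0 , ΣY≡1) = begin
    v                                                      ≡⟨ sym (ℚP.*-identityʳ v) ⟩
    v * 1ℚ                                                 ≡⟨ cong (v *_) (trans (sym ΣY≡1) (ΣFin≡sum Y)) ⟩
    v * sum Y                                              ≡⟨ *-distribˡ-sum v Y ⟩
    sum (λ j → v * Y j)
      ≤⟨ sum-mono-≤ (λ j → ℚP.*-monoʳ-≤-nonNeg (Y j) {{nonNegative (Y≥0 j)}} (columns j)) ⟩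
    sum (λ j → sum (λ i → X i * fromℕ (A i j)) * Y j)      ≡⟨ sum-cong-≗ {n} (λ j → *-distribʳ-sum (Y j) (λ i → X i * fromℕ (A i j))) ⟩
    sum (λ j → sum (λ i → X i * fromℕ (A i j) * Y j))      ≡⟨ sum-cong-≗ {n} (λ j → sum-cong-≗ {n} (λ i → ℚP.*-assoc (X i) _ (Y j))) ⟩
    sum (λ j → sum (λ i → X i * (fromℕ (A i j) * Y j)))    ≡⟨ sym (∑-comm (λ i j → X i * (fromℕ (A i j) * Y j))) ⟩
    sum (λ i → sum (λ j → X i * (fromℕ (A i j) * Y j)))    ≡⟨ sym (ΣFin²≡sum² (λ i j → X i * (fromℕ (A i j) * Y j))) ⟩
    ΣFin (λ i → ΣFin (λ j → X i * (fromℕ (A i j) * Y j)))  ∎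
    where open ℚP.≤-Reasoning

  gain-≤-byRows : ∀ {n} (X Y : Fin n → ℚ) (A : Fin n → Fin n → ℕ) v →
    (∀ i → sum (λ j → fromℕ (A i j) * Y j) ≤ v) → IsMixed X →
    ΣFin (λ i → ΣFin (λ j → X i * (fromℕ (A i j) * Y j))) ≤ v
  gain-≤-byRows {n} X Y A v rows (X≥0 , ΣX≡1) = begin
    ΣFin (λ i → ΣFin (λ j → X i * (fromℕ (A i j) * Y j)))  ≡⟨ ΣFin²≡sum² (λ i j → X i * (fromℕ (A i j) * Y j)) ⟩
    sum (λ i → sum (λ j → X i * (fromℕ (A i j) * Y j)))
      ≡⟨ sum-cong-≗ {n} (λ i → sym (*-distribˡ-sum (X i) (λ j → fromℕ (A i j) * Y j))) ⟩
    sum (λ i → X i * sum (λ j → fromℕ (A i j) * Y j))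
      ≤⟨ sum-mono-≤ (λ i → ℚP.*-monoˡ-≤-nonNeg (X i) {{nonNegative (X≥0 i)}} (rows i)) ⟩
    sum (λ i → X i * v)                                    ≡⟨ sym (*-distribʳ-sum v X) ⟩
    sum X * v                                              ≡⟨ cong (_* v) (trans (sym (ΣFin≡sum X)) ΣX≡1) ⟩
    1ℚ * v                                                 ≡⟨ ℚP.*-identityˡ v ⟩
    v                                                      ∎
    where open ℚP.≤-Reasoning


module HeapTree (k h : Data.Nat.ℕ) where

  open import Data.Nat as ℕ using (ℕ; zero; suc; _+_; _*_; _∸_; _^_; _≤_; _<_; z≤n; s≤s)
  open import Data.Nat.Properties
  open import Data.Nat.DivMod
  open import Data.Nat.Solver using (module +-*-Solver)
  open +-*-Solver using (solve; _:+_; _:*_; _:=_; con)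
  open import Data.Bool using (Bool; true; false; _∨_; T)
  open import Data.Bool.Properties using (T-∧; T-∨)
  open import Function.Bundles using (Equivalence)
  open import Data.Fin using (Fin; toℕ)
  open import Data.Product using (_×_; _,_; proj₁; Σ)
  open import Data.Sum using (_⊎_; inj₁; inj₂)
  open import Data.Empty using (⊥; ⊥-elim)
  open import Data.Unit using (tt)
  open import Relation.Binary.PropositionalEquality
  open import Relation.Nullary using (¬_; yes; no)
  open import Relation.Binary using (tri<; tri≈; tri>)
  open import Defs using (treeSize; parent; depth; depthF; isParentOf)
  open FiniteSums

  m : ℕ
  m = suc k

  nodes : ℕ → ℕ
  nodes t = treeSize m t

  n : ℕ
  n = nodes h

  sumBelow : ℕ → (ℕ → ℕ) → ℕ
  sumBelow zero f = 0
  sumBelow (suc K) f = sumBelow K f + f K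

  nodes-suc : ∀ t → nodes (suc t) ≡ m * nodes t + 1
  nodes-suc zero = trans (+-comm 1 (m ^ 1)) (cong (_+ 1) (trans (*-identityʳ m) (sym (*-identityʳ m))))
  nodes-suc (suc t) = begin
    nodes (suc t) + m * m ^ suc t      ≡⟨ cong (_+ m * m ^ suc t) (nodes-suc t) ⟩
    (m * nodes t + 1) + m * m ^ suc t
      ≡⟨ solve 3 (λ a b c → (a :* b :+ con 1) :+ a :* c := a :* (b :+ c) :+ con 1) refl m (nodes t) (m ^ suc t) ⟩
    m * (nodes t + m ^ suc t) + 1      ∎
    where open ≡-Reasoning

  nodes-1 : nodes 1 ≡ suc m
  nodes-1 = cong suc (*-identityʳ m)

  k*nodes+1≡m^suc : ∀ t → k * nodes t + 1 ≡ m ^ suc t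
  k*nodes+1≡m^suc zero = trans (cong (_+ 1) (*-identityʳ k)) (trans (+-comm k 1) (sym (*-identityʳ m)))
  k*nodes+1≡m^suc (suc t) = begin
    k * nodes (suc t) + 1      ≡⟨ cong (λ z → k * z + 1) (nodes-suc t) ⟩
    k * (m * nodes t + 1) + 1
      ≡⟨ solve 2 (λ kk a → kk :* ((con 1 :+ kk) :* a :+ con 1) :+ con 1 := (con 1 :+ kk) :* (kk :* a :+ con 1)) refl k (nodes t) ⟩
    m * (k * nodes t + 1)      ≡⟨ cong (m *_) (k*nodes+1≡m^suc t) ⟩
    m * m ^ suc t              ∎
    where open ≡-Reasoning

  nodes≡sumBelow : ∀ t → nodes t ≡ sumBelow (suc t) (m ^_)
  nodes≡sumBelow zero = refl
  nodes≡sumBelow (suc t) = cong (_+ m ^ suc t) (nodes≡sumBelow t)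

  m^≡k*sumBelow+1 : ∀ t → m ^ t ≡ k * sumBelow t (m ^_) + 1
  m^≡k*sumBelow+1 zero = cong (_+ 1) (sym (*-zeroʳ k))
  m^≡k*sumBelow+1 (suc t) = begin
    m * m ^ t                  ≡⟨ cong (m *_) (m^≡k*sumBelow+1 t) ⟩
    m * (k * S + 1)
      ≡⟨ solve 2 (λ kk S → (con 1 :+ kk) :* (kk :* S :+ con 1) := kk :* (S :+ (kk :* S :+ con 1)) :+ con 1) refl k S ⟩
    k * (S + (k * S + 1)) + 1  ≡⟨ cong (λ z → k * (S + z) + 1) (sym (m^≡k*sumBelow+1 t)) ⟩
    k * (S + m ^ t) + 1        ∎
    where
    open ≡-Reasoning
    S = sumBelow t (m ^_)

  nodes≡m*sumBelow+1 : ∀ t → nodes t ≡ m * sumBelow t (m ^_) + 1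
  nodes≡m*sumBelow+1 t = begin
    nodes t          ≡⟨ nodes≡sumBelow t ⟩
    S + m ^ t        ≡⟨ cong (S +_) (m^≡k*sumBelow+1 t) ⟩
    S + (k * S + 1)  ≡⟨ solve 2 (λ kk S → S :+ (kk :* S :+ con 1) := (con 1 :+ kk) :* S :+ con 1) refl k S ⟩
    m * S + 1        ∎
    where
    open ≡-Reasoning
    S = sumBelow t (m ^_)

  sum-sumBelow : ∀ {N} K (g : ℕ → Fin N → ℕ) → sum (λ i → sumBelow K (λ t → g t i)) ≡ sumBelow K (λ t → sum (g t))
  sum-sumBelow {N} zero g = sum-zero {N} (λ i → refl)
  sum-sumBelow {N} (suc K) g =
    trans (∑-distrib-+ {N} (λ i → sumBelow K (λ t → g t i)) (g K)) (cong (_+ sum (g K)) (sum-sumBelow K g))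

  sumBelow-mono : ∀ K {f g : ℕ → ℕ} → (∀ t → t < K → f t ≤ g t) → sumBelow K f ≤ sumBelow K g
  sumBelow-mono zero f≤g = z≤n
  sumBelow-mono (suc K) f≤g = +-mono-≤ (sumBelow-mono K (λ t t<K → f≤g t (≤-trans t<K (n≤1+n K)))) (f≤g K ≤-refl)

  sumBelow-cong : ∀ K {f g : ℕ → ℕ} → (∀ t → t < K → f t ≡ g t) → sumBelow K f ≡ sumBelow K g
  sumBelow-cong zero f≡g = refl
  sumBelow-cong (suc K) f≡g = cong₂ _+_ (sumBelow-cong K (λ t t<K → f≡g t (≤-trans t<K (n≤1+n K)))) (f≡g K ≤-refl)

  ≤-/m : ∀ L a → m * L ≤ a → L ≤ a / m
  ≤-/m L a le = subst (_≤ a / m) (m*n/n≡m L m) (/-monoˡ-≤ m (subst (_≤ a) (*-comm m L) le))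

  /m-< : ∀ L a → a < m * L → a / m < L
  /m-< L a lt = m<n*o⇒m/o<n (subst (a <_) (*-comm m L) lt)

  m*[a/m]≤a : ∀ a → m * (a / m) ≤ a
  m*[a/m]≤a a = subst (_≤ a) (*-comm (a / m) m) (m/n*n≤m a m)

  a<m*[1+a/m] : ∀ a → a < m * suc (a / m)
  a<m*[1+a/m] a = begin-strict
    a                  ≡⟨ m≡m%n+[m/n]*n a m ⟩
    a % m + a / m * m  <⟨ +-monoˡ-< (a / m * m) (m%n<n a m) ⟩
    m + a / m * m      ≡⟨ cong (m +_) (*-comm (a / m) m) ⟩
    m + m * (a / m)    ≡⟨ sym (*-suc m (a / m)) ⟩
    m * suc (a / m)    ∎
    where open ≤-Reasoning

  parent-≤ : ∀ v → parent m v ≤ v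
  parent-≤ v = ≤-trans (m/n≤m (v ∸ 1) m) (m∸n≤m v 1)

  parent-< : ∀ v → 1 ≤ v → parent m v < v
  parent-< (suc v) _ = s≤s (m/n≤m v m)

  firstDesc : ℕ → ℕ → ℕ
  firstDesc x zero = x
  firstDesc x (suc t) = m * firstDesc x t + 1

  firstDesc-suc : ∀ x t → firstDesc (suc x) t ≡ firstDesc x t + m ^ t
  firstDesc-suc x zero = +-comm 1 x
  firstDesc-suc x (suc t) = begin
    m * firstDesc (suc x) t + 1          ≡⟨ cong (λ z → m * z + 1) (firstDesc-suc x t) ⟩
    m * (firstDesc x t + m ^ t) + 1
      ≡⟨ solve 3 (λ a b c → a :* (b :+ c) :+ con 1 := (a :* b :+ con 1) :+ a :* c) refl m (firstDesc x t) (m ^ t) ⟩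
    (m * firstDesc x t + 1) + m * m ^ t  ∎
    where open ≡-Reasoning

  firstDesc-firstDesc : ∀ x a t → firstDesc (firstDesc x a) t ≡ firstDesc x (t + a)
  firstDesc-firstDesc x a zero = refl
  firstDesc-firstDesc x a (suc t) = cong (λ z → m * z + 1) (firstDesc-firstDesc x a t)

  firstDesc-1 : ∀ t → firstDesc 1 t ≡ nodes t
  firstDesc-1 zero = refl
  firstDesc-1 (suc t) = trans (cong (λ z → m * z + 1) (firstDesc-1 t)) (sym (nodes-suc t))

  firstDesc-monoˡ : ∀ {x y} t → x ≤ y → firstDesc x t ≤ firstDesc y t
  firstDesc-monoˡ zero x≤y = x≤y
  firstDesc-monoˡ (suc t) x≤y = +-monoˡ-≤ 1 (*-monoʳ-≤ m (firstDesc-monoˡ t x≤y))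

  firstDesc-monoʳ : ∀ x {t₁ t₂} → t₁ ≤ t₂ → firstDesc x t₁ ≤ firstDesc x t₂
  firstDesc-monoʳ x {t₁} {zero} z≤n = ≤-refl
  firstDesc-monoʳ x {zero} {suc t₂} z≤n =
    ≤-trans (firstDesc-monoʳ x {0} {t₂} z≤n) (≤-trans (m≤n*m (firstDesc x t₂) m) (m≤m+n (m * firstDesc x t₂) 1))
  firstDesc-monoʳ x {suc t₁} {suc t₂} (s≤s t₁≤t₂) = +-monoˡ-≤ 1 (*-monoʳ-≤ m (firstDesc-monoʳ x t₁≤t₂))

  firstDesc-pos : ∀ x t → 1 ≤ x → 1 ≤ firstDesc x t
  firstDesc-pos x t 1≤x = ≤-trans 1≤x (firstDesc-monoʳ x {0} {t} z≤n)

  nodes-mono : ∀ {a b} → a ≤ b → nodes a ≤ nodes b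
  nodes-mono {a} {b} a≤b = subst₂ _≤_ (firstDesc-1 a) (firstDesc-1 b) (firstDesc-monoʳ 1 a≤b)

  nodes≤firstDesc : ∀ x d t → nodes d ≤ x → nodes (t + d) ≤ firstDesc x t
  nodes≤firstDesc x d t nodes-d≤x = begin
    nodes (t + d)            ≡⟨ sym (firstDesc-1 (t + d)) ⟩
    firstDesc 1 (t + d)      ≡⟨ sym (firstDesc-firstDesc 1 d t) ⟩
    firstDesc (firstDesc 1 d) t  ≤⟨ firstDesc-monoˡ t (subst (_≤ x) (sym (firstDesc-1 d)) nodes-d≤x) ⟩
    firstDesc x t            ∎
    where open ≤-Reasoning

  firstDesc≤nodes : ∀ x d t → x < nodes (suc d) → firstDesc (suc x) t ≤ nodes (suc t + d)
  firstDesc≤nodes x d t x<nodes = begin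
    firstDesc (suc x) t                ≤⟨ firstDesc-monoˡ t (subst (suc x ≤_) (sym (firstDesc-1 (suc d))) x<nodes) ⟩
    firstDesc (firstDesc 1 (suc d)) t  ≡⟨ firstDesc-firstDesc 1 (suc d) t ⟩
    firstDesc 1 (t + suc d)            ≡⟨ cong (firstDesc 1) (+-suc t d) ⟩
    firstDesc 1 (suc t + d)            ≡⟨ firstDesc-1 (suc t + d) ⟩
    nodes (suc t + d)                  ∎
    where open ≤-Reasoning

  firstDesc-gap : ∀ x t → 1 ≤ x → firstDesc (suc x) t ≤ firstDesc x (suc t)
  firstDesc-gap x t 1≤x = begin
    firstDesc (suc x) t                      ≡⟨ firstDesc-suc x t ⟩
    firstDesc x t + m ^ t                    ≤⟨ +-monoʳ-≤ (firstDesc x t) m^t≤ ⟩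
    firstDesc x t + (k * firstDesc x t + 1)
      ≡⟨ solve 2 (λ kk a → a :+ (kk :* a :+ con 1) := (con 1 :+ kk) :* a :+ con 1) refl k (firstDesc x t) ⟩
    m * firstDesc x t + 1                    ∎
    where
    open ≤-Reasoning
    m^t≤ : m ^ t ≤ k * firstDesc x t + 1
    m^t≤ = begin
      m ^ t                  ≤⟨ m≤n*m (m ^ t) m ⟩
      m ^ suc t              ≡⟨ sym (k*nodes+1≡m^suc t) ⟩
      k * nodes t + 1        ≤⟨ +-monoˡ-≤ 1 (*-monoʳ-≤ k (subst (_≤ firstDesc x t) (firstDesc-1 t) (firstDesc-monoˡ t 1≤x))) ⟩
      k * firstDesc x t + 1  ∎

  -- In heap order the descendants of x at relative depth t are exactly the vertices of
  -- the interval [firstDesc x t, firstDesc (x + 1) t).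
  DescAt : ℕ → ℕ → ℕ → Set
  DescAt x t v = firstDesc x t ≤ v × v < firstDesc (suc x) t

  Desc : ℕ → ℕ → Set
  Desc x v = Σ ℕ λ t → DescAt x t v

  DescAt-parent : ∀ x t v → DescAt x (suc t) v → DescAt x t (parent m v)
  DescAt-parent x t zero (lo , _) = ⊥-elim (n≮0 (≤-trans (m≤n+m 1 (m * firstDesc x t)) lo))
  DescAt-parent x t (suc v) (lo , hi) =
    ≤-/m (firstDesc x t) v (≤-pred (subst (_≤ suc v) (+-comm (m * firstDesc x t) 1) lo)) ,
    /m-< (firstDesc (suc x) t) v (≤-pred (subst (suc (suc v) ≤_) (+-comm (m * firstDesc (suc x) t) 1) hi))

  DescAt-child : ∀ x t v → 1 ≤ v → DescAt x t (parent m v) → DescAt x (suc t) v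
  DescAt-child x t (suc v) _ (lo , hi) =
    subst (_≤ suc v) (+-comm 1 (m * firstDesc x t)) (s≤s (≤-trans (*-monoʳ-≤ m lo) (m*[a/m]≤a v))) ,
    subst (suc (suc v) ≤_) (+-comm 1 (m * firstDesc (suc x) t)) (s≤s (<-≤-trans (a<m*[1+a/m] v) (*-monoʳ-≤ m hi)))

  DescAt-self : ∀ x → DescAt x 0 x
  DescAt-self x = ≤-refl , ≤-refl

  DescAt-zero : ∀ x v → DescAt x 0 v → v ≡ x
  DescAt-zero x v (lo , hi) = ≤-antisym (≤-pred hi) lo

  DescAt-pos : ∀ x t v → 1 ≤ x → DescAt x t v → 1 ≤ v
  DescAt-pos x t v 1≤x (lo , _) = ≤-trans (firstDesc-pos x t 1≤x) lo

  DescAt-trans : ∀ x y t v → 1 ≤ y → DescAt y t v → DescAt x 1 y → DescAt x (suc t) v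
  DescAt-trans x y zero v 1≤y y→v x→y = subst (DescAt x 1) (sym (DescAt-zero y v y→v)) x→y
  DescAt-trans x y (suc t) v 1≤y y→v x→y =
    DescAt-child x (suc t) v (DescAt-pos y (suc t) v 1≤y y→v) (DescAt-trans x y t (parent m v) 1≤y (DescAt-parent y t v y→v) x→y)

  child-DescAt : ∀ g → 1 ≤ g → DescAt (parent m g) 1 g
  child-DescAt g 1≤g = DescAt-child (parent m g) 0 g 1≤g (DescAt-self (parent m g))

  DescAt-depth : ∀ x d t v → nodes d ≤ x → x < nodes (suc d) → DescAt x t v → nodes (t + d) ≤ v × v < nodes (suc t + d)
  DescAt-depth x d t v lo hi (x→v-lo , x→v-hi) = ≤-trans (nodes≤firstDesc x d t lo) x→v-lo , <-≤-trans x→v-hi (firstDesc≤nodes x d t hi)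

  DescAt-unique : ∀ {x y} t {v} → DescAt x t v → DescAt y t v → x ≡ y
  DescAt-unique {x} {y} t (x-lo , x-hi) (y-lo , y-hi) with <-cmp x y
  ... | tri< x<y _ _ = ⊥-elim (<⇒≱ x-hi (≤-trans (firstDesc-monoˡ t x<y) y-lo))
  ... | tri≈ _ x≡y _ = x≡y
  ... | tri> _ _ y<x = ⊥-elim (<⇒≱ y-hi (≤-trans (firstDesc-monoˡ t y<x) x-lo))

  depth-unique : ∀ {t t′ d v} → nodes (t + d) ≤ v → v < nodes (suc t + d) → nodes (t′ + d) ≤ v → v < nodes (suc t′ + d) → t ≡ t′
  depth-unique {t} {t′} {d} lo hi lo′ hi′ with <-cmp t t′
  ... | tri< t<t′ _ _ = ⊥-elim (<⇒≱ hi (≤-trans (nodes-mono (+-monoˡ-≤ d t<t′)) lo′))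
  ... | tri≈ _ t≡t′ _ = t≡t′
  ... | tri> _ _ t′<t = ⊥-elim (<⇒≱ hi′ (≤-trans (nodes-mono (+-monoˡ-≤ d t′<t)) lo))

  DescAt-height : ∀ x t v → 1 ≤ x → DescAt x t v → v < n → t < h
  DescAt-height x t v 1≤x (lo , _) v<n with t ℕ.<? h
  ... | yes t<h = t<h
  ... | no t≮h = ⊥-elim (<⇒≱ v<n (≤-trans (nodes-mono (≮⇒≥ t≮h))
                   (≤-trans (≤-reflexive (sym (firstDesc-1 t))) (≤-trans (firstDesc-monoˡ t 1≤x) lo))))

  anyBelow : ℕ → (ℕ → Bool) → Bool
  anyBelow zero p = false
  anyBelow (suc K) p = anyBelow K p ∨ p K

  anyBelow-intro : ∀ K p t → t < K → T (p t) → T (anyBelow K p)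
  anyBelow-intro (suc K) p t t<K pt with t ℕ.≟ K
  ... | yes refl = Equivalence.from T-∨ (inj₂ pt)
  ... | no t≢K = Equivalence.from T-∨ (inj₁ (anyBelow-intro K p t (≤∧≢⇒< (≤-pred t<K) t≢K) pt))

  anyBelow-elim : ∀ K p → T (anyBelow K p) → Σ ℕ λ t → t < K × T (p t)
  anyBelow-elim (suc K) p q with anyBelow K p in below
  ... | true = let (t , t<K , pt) = anyBelow-elim K p (subst T (sym below) tt) in t , ≤-trans t<K (n≤1+n K) , pt
  ... | false = K , ≤-refl , q

  descAtᵇ : ℕ → ℕ → ℕ → Bool
  descAtᵇ x t v = inRange (firstDesc x t) (firstDesc (suc x) t) v

  descAtᵇ-intro : ∀ x t v → DescAt x t v → T (descAtᵇ x t v)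
  descAtᵇ-intro x t v (lo , hi) = Equivalence.from T-∧ (≤⇒≤ᵇ lo , <⇒<ᵇ hi)

  descAtᵇ-elim : ∀ x t v → T (descAtᵇ x t v) → DescAt x t v
  descAtᵇ-elim x t v p = let (lo , hi) = Equivalence.to T-∧ p in ≤ᵇ⇒≤ _ _ lo , <ᵇ⇒< _ _ hi

  inSubtree : ℕ → ℕ → Bool
  inSubtree x v = anyBelow h (λ t → descAtᵇ x t v)

  inSubtree-intro : ∀ x v → 1 ≤ x → v < n → Desc x v → T (inSubtree x v)
  inSubtree-intro x v 1≤x v<n (t , x→v) =
    anyBelow-intro h (λ t → descAtᵇ x t v) t (DescAt-height x t v 1≤x x→v v<n) (descAtᵇ-intro x t v x→v)

  inSubtree-elim : ∀ x v → T (inSubtree x v) → Desc x v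
  inSubtree-elim x v v∈x = let (t , _ , x→v) = anyBelow-elim h (λ t → descAtᵇ x t v) v∈x in t , descAtᵇ-elim x t v x→v

  inSubtree-child : ∀ x v → 1 ≤ x → 1 ≤ v → v < n → T (inSubtree x (parent m v)) → T (inSubtree x v)
  inSubtree-child x v 1≤x 1≤v v<n pv∈x =
    let (t , x→pv) = inSubtree-elim x (parent m v) pv∈x in inSubtree-intro x v 1≤x v<n (suc t , DescAt-child x t v 1≤v x→pv)

  inSubtree-parent : ∀ x v → 1 ≤ x → v < n → T (inSubtree x v) → v ≢ x → T (inSubtree x (parent m v))
  inSubtree-parent x v 1≤x v<n v∈x v≢x with inSubtree-elim x v v∈x
  ... | zero , x→v = ⊥-elim (v≢x (DescAt-zero x v x→v))
  ... | suc t , x→v = inSubtree-intro x (parent m v) 1≤x (≤-<-trans (parent-≤ v) v<n) (t , DescAt-parent x t v x→v)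

  inSubtree-root : ∀ x → 1 ≤ x → x < n → T (inSubtree x x)
  inSubtree-root x 1≤x x<n = inSubtree-intro x x 1≤x x<n (0 , DescAt-self x)

  inSubtree-0 : ∀ x → 1 ≤ x → T (inSubtree x 0) → ⊥
  inSubtree-0 x 1≤x 0∈x = let (t , x→0) = inSubtree-elim x 0 0∈x in n≮0 (DescAt-pos x t 0 1≤x x→0)

  inSubtree-≥ : ∀ x v → T (inSubtree x v) → x ≤ v
  inSubtree-≥ x v v∈x = let (t , (lo , _)) = inSubtree-elim x v v∈x in ≤-trans (firstDesc-monoʳ x {0} {t} z≤n) lo

  indicator-inSubtree : ∀ x v K → 1 ≤ x → indicator (anyBelow K (λ t → descAtᵇ x t v)) ≡ sumBelow K (λ t → indicator (descAtᵇ x t v))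
  indicator-inSubtree x v zero 1≤x = refl
  indicator-inSubtree x v (suc K) 1≤x =
    trans (indicator-∨ (anyBelow K (λ t → descAtᵇ x t v)) (descAtᵇ x K v) disjoint)
          (cong (_+ indicator (descAtᵇ x K v)) (indicator-inSubtree x v K 1≤x))
    where
    disjoint : T (anyBelow K (λ t → descAtᵇ x t v)) → T (descAtᵇ x K v) → ⊥
    disjoint earlier atK =
      let (t , t<K , at-t) = anyBelow-elim K (λ t → descAtᵇ x t v) earlier
          (_ , v<end) = descAtᵇ-elim x t v at-t
          (start≤v , _) = descAtᵇ-elim x K v atK
      in <⇒≱ v<end (≤-trans (firstDesc-gap x t 1≤x) (≤-trans (firstDesc-monoʳ x t<K) start≤v))

  count-inSubtree : ∀ x → 1 ≤ x → count {n} (λ i → inSubtree x (toℕ i)) ≡ sumBelow h (λ t → count {n} (λ i → descAtᵇ x t (toℕ i)))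
  count-inSubtree x 1≤x = trans (sum-cong-≗ {n} (λ i → indicator-inSubtree x (toℕ i) h 1≤x))
    (sum-sumBelow {n} h (λ t i → indicator (descAtᵇ x t (toℕ i))))

  count-descAt : ∀ x t → firstDesc (suc x) t ≤ n → count {n} (λ i → descAtᵇ x t (toℕ i)) ≡ m ^ t
  count-descAt x t end≤n =
    trans (sum-cong-≗ {n} (λ i → cong (λ z → indicator (inRange (firstDesc x t) z (toℕ i))) (firstDesc-suc x t)))
          (count-inRange-inside n (firstDesc x t) (m ^ t) (subst (_≤ n) (firstDesc-suc x t) end≤n))

  count-descAt-≤ : ∀ x t → count {n} (λ i → descAtᵇ x t (toℕ i)) ≤ m ^ t
  count-descAt-≤ x t =
    subst (_≤ m ^ t) (sum-cong-≗ {n} (λ i → cong (λ z → indicator (inRange (firstDesc x t) z (toℕ i))) (sym (firstDesc-suc x t))))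
          (count-inRange-≤ n (firstDesc x t) (m ^ t))

  count-subtree-depth1 : ∀ x → 1 ≤ x → x < nodes 1 → count {n} (λ i → inSubtree x (toℕ i)) ≡ sumBelow h (m ^_)
  count-subtree-depth1 x 1≤x x<nodes1 = trans (count-inSubtree x 1≤x) (sumBelow-cong h (λ t t<h →
    count-descAt x t (≤-trans (firstDesc≤nodes x 0 t x<nodes1) (nodes-mono (≤-trans (≤-reflexive (+-identityʳ (suc t))) t<h)))))

  -- Relative depth h - 1 below a depth-2 vertex lies outside the tree.
  count-subtree-depth2-≤ : ∀ x h′ → h ≡ suc h′ → nodes 1 ≤ x → x < nodes 2 → count {n} (λ i → inSubtree x (toℕ i)) ≤ sumBelow h′ (m ^_)
  count-subtree-depth2-≤ x h′ refl nodes1≤x x<nodes2 = begin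
    count {n} (λ i → inSubtree x (toℕ i))
      ≡⟨ count-inSubtree x (≤-trans (s≤s z≤n) nodes1≤x) ⟩
    sumBelow h′ (λ t → count {n} (λ i → descAtᵇ x t (toℕ i))) + count {n} (λ i → descAtᵇ x h′ (toℕ i))
      ≡⟨ cong (sumBelow h′ (λ t → count {n} (λ i → descAtᵇ x t (toℕ i))) +_)
              (count-inRange-beyond n (firstDesc x h′) (firstDesc (suc x) h′)
                 (subst (_≤ firstDesc x h′) (cong nodes (+-comm h′ 1)) (nodes≤firstDesc x 1 h′ nodes1≤x))) ⟩
    sumBelow h′ (λ t → count {n} (λ i → descAtᵇ x t (toℕ i))) + 0
      ≡⟨ +-identityʳ _ ⟩
    sumBelow h′ (λ t → count {n} (λ i → descAtᵇ x t (toℕ i)))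
      ≤⟨ sumBelow-mono h′ (λ t _ → count-descAt-≤ x t) ⟩
    sumBelow h′ (m ^_) ∎
    where open ≤-Reasoning

  parent-depth1 : ∀ x → 1 ≤ x → x < nodes 1 → parent m x ≡ 0
  parent-depth1 (suc x) _ x<nodes1 = m<n⇒m/n≡0 (≤-pred (subst (suc (suc x) ≤_) nodes-1 x<nodes1))

  parent-depth2 : ∀ g → nodes 1 ≤ g → g < nodes 2 → 1 ≤ parent m g × parent m g < nodes 1
  parent-depth2 (suc g) nodes1≤g g<nodes2 =
    ≤-/m 1 g (≤-pred nodes1≤g) ,
    /m-< (nodes 1) g (≤-pred (subst (suc (suc g) ≤_) (trans (nodes-suc 1) (+-comm (m * nodes 1) 1)) g<nodes2))

  depth1-ancestor-unique : ∀ x y v → 1 ≤ x → x < nodes 1 → 1 ≤ y → y < nodes 1 → T (inSubtree x v) → T (inSubtree y v) → x ≡ y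
  depth1-ancestor-unique x y v 1≤x x<nodes1 1≤y y<nodes1 v∈x v∈y =
    let (t , x→v) = inSubtree-elim x v v∈x
        (t′ , y→v) = inSubtree-elim y v v∈y
        (lo , hi) = DescAt-depth x 0 t v 1≤x x<nodes1 x→v
        (lo′ , hi′) = DescAt-depth y 0 t′ v 1≤y y<nodes1 y→v
    in DescAt-unique t x→v (subst (λ τ → DescAt y τ v) (sym (depth-unique {t} {t′} {0} lo hi lo′ hi′)) y→v)

  ancestorAtDepth : ∀ d fuel v → v < fuel → nodes d ≤ v → Σ ℕ λ y → nodes d ≤ y × y < nodes (suc d) × Desc y v
  ancestorAtDepth d (suc fuel) v v<fuel nodes-d≤v with v ℕ.<? nodes (suc d)
  ... | yes v<next = v , nodes-d≤v , v<next , (0 , DescAt-self v)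
  ... | no v≮next =
    let next≤v = ≮⇒≥ v≮next
        1≤v = ≤-trans (subst (1 ≤_) (firstDesc-1 (suc d)) (firstDesc-pos 1 (suc d) (s≤s z≤n))) next≤v
        nodes-d≤pv = ≤-/m (nodes d) (v ∸ 1) (m+n≤o⇒m≤o∸n (m * nodes d) (subst (_≤ v) (nodes-suc d) next≤v))
        (y , nodes-d≤y , y<next , (t , y→pv)) =
          ancestorAtDepth d fuel (parent m v) (≤-trans (parent-< v 1≤v) (≤-pred v<fuel)) nodes-d≤pv
    in y , nodes-d≤y , y<next , (suc t , DescAt-child y t v 1≤v y→pv)

  depth1-ancestor : ∀ v → 1 ≤ v → v < n → Σ ℕ λ c → 1 ≤ c × c < nodes 1 × T (inSubtree c v)
  depth1-ancestor v 1≤v v<n =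
    let (c , 1≤c , c<nodes1 , c→v) = ancestorAtDepth 0 (suc v) v ≤-refl 1≤v
    in c , 1≤c , c<nodes1 , inSubtree-intro c v 1≤c v<n c→v

  depth2-ancestor : ∀ v → nodes 1 ≤ v → v < n →
    Σ ℕ λ g → nodes 1 ≤ g × g < nodes 2 × T (inSubtree g v) × T (inSubtree (parent m g) v)
  depth2-ancestor v nodes1≤v v<n =
    let (g , nodes1≤g , g<nodes2 , (t , g→v)) = ancestorAtDepth 1 (suc v) v ≤-refl nodes1≤v
        1≤g = ≤-trans (s≤s z≤n) nodes1≤g
    in g , nodes1≤g , g<nodes2 , inSubtree-intro g v 1≤g v<n (t , g→v) ,
       inSubtree-intro (parent m g) v (proj₁ (parent-depth2 g nodes1≤g g<nodes2)) v<n
         (suc t , DescAt-trans (parent m g) g t v 1≤g g→v (child-DescAt g 1≤g))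

  depth-1 : ∀ v → 1 ≤ v → v < nodes 1 → depth m v ≡ 1
  depth-1 (suc v) _ v<nodes1 = cong suc (root-depth v (m<n⇒m/n≡0 (≤-pred (subst (suc (suc v) ≤_) nodes-1 v<nodes1))))
    where
    root-depth : ∀ fuel → v / m ≡ 0 → depthF m fuel (v / m) ≡ 0
    root-depth zero _ = refl
    root-depth (suc fuel) v/m≡0 rewrite v/m≡0 = refl

  depth-≥2 : ∀ v → nodes 1 ≤ v → Σ ℕ λ d → depth m v ≡ suc (suc d)
  depth-≥2 (suc zero) nodes1≤1 = ⊥-elim (<⇒≱ (s≤s (s≤s z≤n)) (subst (_≤ 1) nodes-1 nodes1≤1))
  depth-≥2 (suc (suc v)) nodes1≤v with suc v / m in parent≡
  ... | zero = ⊥-elim (<⇒≱ (m/n≡0⇒m<n parent≡) (≤-pred (subst (_≤ suc (suc v)) nodes-1 nodes1≤v)))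
  ... | suc _ = _ , refl

  adjacent : ℕ → ℕ → Bool
  adjacent a b = isParentOf m a b ∨ isParentOf m b a

  isParentOf-elim : ∀ a b → T (isParentOf m a b) → 1 ≤ b × parent m b ≡ a
  isParentOf-elim a (suc b) a-parent = s≤s z≤n , ≡ᵇ⇒≡ (parent m (suc b)) a a-parent

  isParentOf-intro : ∀ v → 1 ≤ v → T (isParentOf m (parent m v) v)
  isParentOf-intro (suc v) _ = ≡⇒≡ᵇ (parent m (suc v)) (parent m (suc v)) refl

  adjacent-elim : ∀ a b → T (adjacent a b) → (1 ≤ b × parent m b ≡ a) ⊎ (1 ≤ a × parent m a ≡ b)
  adjacent-elim a b ab with Equivalence.to (T-∨ {isParentOf m a b}) ab
  ... | inj₁ a-parent = inj₁ (isParentOf-elim a b a-parent)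
  ... | inj₂ b-parent = inj₂ (isParentOf-elim b a b-parent)

  adjacent-sym : ∀ a b → T (adjacent a b) → T (adjacent b a)
  adjacent-sym a b ab with Equivalence.to (T-∨ {isParentOf m a b}) ab
  ... | inj₁ a-parent = Equivalence.from (T-∨ {isParentOf m b a}) (inj₂ a-parent)
  ... | inj₂ b-parent = Equivalence.from (T-∨ {isParentOf m b a}) (inj₁ b-parent)

  adjacent-toParent : ∀ v → 1 ≤ v → T (adjacent v (parent m v))
  adjacent-toParent v 1≤v = Equivalence.from T-∨ (inj₂ (isParentOf-intro v 1≤v))

  adjacent-fromParent : ∀ v → 1 ≤ v → T (adjacent (parent m v) v)
  adjacent-fromParent v 1≤v = Equivalence.from T-∨ (inj₁ (isParentOf-intro v 1≤v))

  adjacent-root-depth1 : ∀ j → 1 ≤ j → j < nodes 1 → T (adjacent 0 j)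
  adjacent-root-depth1 j 1≤j j<nodes1 = subst (λ z → T (adjacent z j)) (parent-depth1 j 1≤j j<nodes1) (adjacent-fromParent j 1≤j)

  edge-leaving-subtree : ∀ x u v → 1 ≤ x → u < n → v < n → T (adjacent u v) → T (inSubtree x u) → ¬ T (inSubtree x v) →
    u ≡ x × v ≡ parent m x
  edge-leaving-subtree x u v 1≤x u<n v<n uv u∈x v∉x with adjacent-elim u v uv
  ... | inj₁ (1≤v , pv≡u) = ⊥-elim (v∉x (inSubtree-child x v 1≤x 1≤v v<n (subst (λ z → T (inSubtree x z)) (sym pv≡u) u∈x)))
  ... | inj₂ (1≤u , pu≡v) with u ℕ.≟ x
  ...   | yes u≡x = u≡x , trans (sym pu≡v) (cong (parent m) u≡x)
  ...   | no u≢x = ⊥-elim (v∉x (subst (λ z → T (inSubtree x z)) pu≡v (inSubtree-parent x u 1≤x u<n u∈x u≢x)))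


module Diffusion (G : Defs.Graph) (a b : Data.Fin.Fin (Defs.size G)) where

  open import Defs hiding (T)
  open import Data.Nat as ℕ using (ℕ; zero; suc; _+_; _≤_; _<_; _≡ᵇ_)
  open import Data.Nat.Properties using (≡ᵇ⇒≡; ≡⇒≡ᵇ; ≤-trans; ≤-pred; <-≤-trans; +-identityʳ; +-comm; n≮0)
  open import Data.Bool using (Bool; true; false; _∧_; T)
  open import Data.Bool.Properties using (T-∧; T-≡; T?)
  open import Data.Fin using (Fin; toℕ)
  import Data.Fin as F
  open import Data.Fin.Properties using (toℕ-injective)
  open import Data.Product using (_×_; _,_; Σ)
  open import Data.Sum using (_⊎_; inj₁; inj₂)
  open import Data.Empty using (⊥; ⊥-elim)
  open import Data.Unit using (tt)
  open import Function.Bundles using (Equivalence)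
  open import Relation.Binary.PropositionalEquality
  open import Relation.Nullary using (¬_; yes; no)
  open FiniteSums

  N : ℕ
  N = size G

  anyFin-intro : ∀ {n} (f : Fin n → Bool) u → T (f u) → T (anyFin f)
  anyFin-intro f F.zero p with f F.zero
  ... | true = tt
  anyFin-intro f (F.suc u) p with f F.zero
  ... | true = tt
  ... | false = anyFin-intro (λ i → f (F.suc i)) u p

  anyFin-elim : ∀ {n} (f : Fin n → Bool) → T (anyFin f) → Σ (Fin n) λ u → T (f u)
  anyFin-elim {suc n} f p with f F.zero in f0
  ... | true = F.zero , subst T (sym f0) tt
  ... | false = let (u , q) = anyFin-elim (λ i → f (F.suc i)) p in F.suc u , q

  iterate-suc : ∀ {A : Set} (f : A → A) k x → iterate (suc k) f x ≡ f (iterate k f x)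
  iterate-suc f zero x = refl
  iterate-suc f (suc k) x = iterate-suc f k (f x)

  colouring : ℕ → Fin N → Colour
  colouring k = iterate k (step G) (initial G a b)

  colouring-suc : ∀ k v → colouring (suc k) v ≡ step G (colouring k) v
  colouring-suc k v = cong (λ c → c v) (iterate-suc (step G) k (initial G a b))

  data IsPlayer : Colour → Set where
    player₁ : IsPlayer p1
    player₂ : IsPlayer p2

  owns : ∀ {q} → IsPlayer q → Colour → Bool
  owns player₁ = isP1
  owns player₂ = isP2

  owns-elim : ∀ {q} (pl : IsPlayer q) c → T (owns pl c) → c ≡ q
  owns-elim player₁ p1 _ = refl
  owns-elim player₂ p2 _ = refl

  owns-intro : ∀ {q c} (pl : IsPlayer q) → c ≡ q → T (owns pl c)
  owns-intro player₁ refl = tt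
  owns-intro player₂ refl = tt

  ownedNeighbour : ∀ {q} → IsPlayer q → (Fin N → Colour) → Fin N → Bool
  ownedNeighbour pl c v = anyFin (λ u → adj G v u ∧ owns pl (c u))

  ownedNeighbour-elim : ∀ {q} (pl : IsPlayer q) c v → T (ownedNeighbour pl c v) →
    Σ (Fin N) λ u → T (adj G v u) × c u ≡ q
  ownedNeighbour-elim pl c v owned =
    let (u , adj∧owns) = anyFin-elim (λ u → adj G v u ∧ owns pl (c u)) owned
        (vu , ownsU) = Equivalence.to T-∧ adj∧owns
    in u , vu , owns-elim pl (c u) ownsU

  ownedNeighbour-intro : ∀ {q} (pl : IsPlayer q) c v u → T (adj G v u) → c u ≡ q → ownedNeighbour pl c v ≡ true
  ownedNeighbour-intro pl c v u vu cu≡q =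
    Equivalence.to T-≡ (anyFin-intro (λ w → adj G v w ∧ owns pl (c w)) u (Equivalence.from T-∧ (vu , owns-intro pl cu≡q)))

  contest : Bool → Bool → Colour
  contest true  true  = grey
  contest true  false = p1
  contest false true  = p2
  contest false false = uncol

  step-uncol : ∀ c v → c v ≡ uncol →
    step G c v ≡ contest (ownedNeighbour player₁ c v) (ownedNeighbour player₂ c v)
  step-uncol c v cv≡uncol with isUncol (c v) in uncolᵇ
  ... | false = ⊥-elim (subst (λ z → isUncol z ≡ false → ⊥) (sym cv≡uncol) (λ ()) uncolᵇ)
  ... | true with ownedNeighbour player₁ c v | ownedNeighbour player₂ c v
  ...   | true  | true  = refl
  ...   | true  | false = refl
  ...   | false | true  = refl
  ...   | false | false = refl

  step-coloured : ∀ c v → isUncol (c v) ≡ false → step G c v ≡ c v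
  step-coloured c v coloured with isUncol (c v)
  step-coloured c v refl | false = refl

  persists : ∀ k v → isUncol (colouring k v) ≡ false → colouring (suc k) v ≡ colouring k v
  persists k v coloured = trans (colouring-suc k v) (step-coloured (colouring k) v coloured)

  stays : ∀ j k v → isUncol (colouring k v) ≡ false → colouring (j + k) v ≡ colouring k v
  stays zero k v coloured = refl
  stays (suc j) k v coloured =
    trans (persists (j + k) v (trans (cong isUncol (stays j k v coloured)) coloured)) (stays j k v coloured)

  private
    contest-p1 : ∀ x y → contest x y ≡ p1 → T x
    contest-p1 true false _ = tt
    contest-p1 true true ()
    contest-p1 false true ()
    contest-p1 false false ()

    contest-p2 : ∀ x y → contest x y ≡ p2 → T y
    contest-p2 false true _ = tt
    contest-p2 true true ()
    contest-p2 true false ()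
    contest-p2 false false ()

    uncol-or-coloured : ∀ c → c ≡ uncol ⊎ isUncol c ≡ false
    uncol-or-coloured uncol = inj₁ refl
    uncol-or-coloured p1 = inj₂ refl
    uncol-or-coloured p2 = inj₂ refl
    uncol-or-coloured grey = inj₂ refl

  step-won : ∀ {q} (pl : IsPlayer q) c v → c v ≡ uncol → step G c v ≡ q → T (ownedNeighbour pl c v)
  step-won player₁ c v uncolv won = contest-p1 _ _ (trans (sym (step-uncol c v uncolv)) won)
  step-won player₂ c v uncolv won = contest-p2 _ _ (trans (sym (step-uncol c v uncolv)) won)

  gained-from-neighbour : ∀ {q} (pl : IsPlayer q) k v → colouring (suc k) v ≡ q →
    colouring k v ≡ q ⊎ Σ (Fin N) λ u → T (adj G v u) × colouring k u ≡ q
  gained-from-neighbour pl k v won with uncol-or-coloured (colouring k v)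
  ... | inj₁ uncolk = inj₂ (ownedNeighbour-elim pl (colouring k) v
          (step-won pl (colouring k) v uncolk (trans (sym (colouring-suc k v)) won)))
  ... | inj₂ colk = inj₁ (trans (sym (persists k v colk)) won)

  confined : ∀ {q} (pl : IsPlayer q) (S : Fin N → Bool) →
    (∀ v → colouring 0 v ≡ q → T (S v)) →
    (∀ u v → T (adj G v u) → T (S u) → ¬ T (S v) → ∀ k → colouring k v ≢ q) →
    ∀ k v → colouring k v ≡ q → T (S v)
  confined pl S start border zero v owned = start v owned
  confined pl S start border (suc k) v owned with T? (S v)
  ... | yes Sv = Sv
  ... | no ¬Sv with gained-from-neighbour pl k v owned
  ...   | inj₁ ownedBefore = confined pl S start border k v ownedBefore
  ...   | inj₂ (u , vu , ownedU) = ⊥-elim (border u v vu (confined pl S start border k u ownedU) ¬Sv (suc k) owned)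

  startOf : ∀ {q} → IsPlayer q → Fin N
  startOf player₁ = a
  startOf player₂ = b

  private
    ≡ᵇ-refl : ∀ x → (x ≡ᵇ x) ≡ true
    ≡ᵇ-refl x = Equivalence.to T-≡ (≡⇒≡ᵇ x x refl)

    ≢⇒≡ᵇ-false : ∀ x y → x ≢ y → (x ≡ᵇ y) ≡ false
    ≢⇒≡ᵇ-false x y x≢y = ¬T⇒≡false (λ x≡ᵇy → x≢y (≡ᵇ⇒≡ x y x≡ᵇy))

  initial-owner : ∀ {q} (pl : IsPlayer q) v → colouring 0 v ≡ q → toℕ v ≡ toℕ (startOf pl)
  initial-owner pl v owned with toℕ a ≡ᵇ toℕ b | toℕ v ≡ᵇ toℕ a in v≡a | toℕ v ≡ᵇ toℕ b in v≡b
  initial-owner player₁ v refl | false | true  | _    = ≡ᵇ⇒≡ (toℕ v) (toℕ a) (subst T (sym v≡a) tt)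
  initial-owner player₂ v refl | false | false | true = ≡ᵇ⇒≡ (toℕ v) (toℕ b) (subst T (sym v≡b) tt)
  initial-owner player₁ v ()   | true  | true  | _
  initial-owner player₁ v ()   | true  | false | _
  initial-owner player₁ v ()   | false | false | true
  initial-owner player₁ v ()   | false | false | false
  initial-owner player₂ v ()   | true  | true  | _
  initial-owner player₂ v ()   | true  | false | _
  initial-owner player₂ v ()   | false | true  | _
  initial-owner player₂ v ()   | false | false | false

  initial-a : toℕ a ≢ toℕ b → colouring 0 a ≡ p1
  initial-a a≢b rewrite ≢⇒≡ᵇ-false (toℕ a) (toℕ b) a≢b | ≡ᵇ-refl (toℕ a) = refl

  initial-b : toℕ a ≢ toℕ b → colouring 0 b ≡ p2
  initial-b a≢b rewrite ≢⇒≡ᵇ-false (toℕ a) (toℕ b) a≢b | ≢⇒≡ᵇ-false (toℕ b) (toℕ a) (λ b≡a → a≢b (sym b≡a))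
    | ≡ᵇ-refl (toℕ b) = refl

  initial-other : ∀ v → toℕ a ≢ toℕ b → toℕ v ≢ toℕ a → toℕ v ≢ toℕ b → colouring 0 v ≡ uncol
  initial-other v a≢b v≢a v≢b
    rewrite ≢⇒≡ᵇ-false (toℕ a) (toℕ b) a≢b | ≢⇒≡ᵇ-false (toℕ v) (toℕ a) v≢a | ≢⇒≡ᵇ-false (toℕ v) (toℕ b) v≢b = refl

  initial-diagonal : ∀ v → toℕ a ≡ toℕ b → colouring 0 v ≢ p1
  initial-diagonal v a≡b rewrite Equivalence.to T-≡ (≡⇒≡ᵇ (toℕ a) (toℕ b) a≡b) with toℕ v ≡ᵇ toℕ a
  ... | true = λ ()
  ... | false = λ ()

  a-coloured : toℕ a ≢ toℕ b → ∀ k → colouring k a ≡ p1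
  a-coloured a≢b k = subst (λ j → colouring j a ≡ p1) (+-identityʳ k)
    (trans (stays k 0 a (cong isUncol (initial-a a≢b))) (initial-a a≢b))

  b-coloured : toℕ a ≢ toℕ b → ∀ k → colouring k b ≡ p2
  b-coloured a≢b k = subst (λ j → colouring j b ≡ p2) (+-identityʳ k)
    (trans (stays k 0 b (cong isUncol (initial-b a≢b))) (initial-b a≢b))

  a-never-p2 : toℕ a ≢ toℕ b → ∀ k v → toℕ v ≡ toℕ a → colouring k v ≢ p2
  a-never-p2 a≢b k v v≡a p2ₖ with trans (sym (subst (λ z → colouring k z ≡ p1) (sym (toℕ-injective v≡a)) (a-coloured a≢b k))) p2ₖ
  ... | ()

  b-never-p1 : toℕ a ≢ toℕ b → ∀ k v → toℕ v ≡ toℕ b → colouring k v ≢ p1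
  b-never-p1 a≢b k v v≡b p1ₖ with trans (sym (subst (λ z → colouring k z ≡ p2) (sym (toℕ-injective v≡b)) (b-coloured a≢b k))) p1ₖ
  ... | ()

  -- In round 1 such a vertex is already grey or Player 2's.
  neighbour-of-b-never-p1 : ∀ v → toℕ a ≢ toℕ b → toℕ v ≢ toℕ a → toℕ v ≢ toℕ b → T (adj G v b) →
    ∀ k → colouring k v ≢ p1
  neighbour-of-b-never-p1 v a≢b v≢a v≢b vb zero p1₀ with trans (sym (initial-other v a≢b v≢a v≢b)) p1₀
  ... | ()
  neighbour-of-b-never-p1 v a≢b v≢a v≢b vb (suc k) p1ₖ = never (ownedNeighbour player₁ (colouring 0) v) round1
    where
    round1 : colouring 1 v ≡ contest (ownedNeighbour player₁ (colouring 0) v) true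
    round1 = trans (colouring-suc 0 v) (trans (step-uncol (colouring 0) v (initial-other v a≢b v≢a v≢b))
      (cong (contest _) (ownedNeighbour-intro player₂ (colouring 0) v b vb (initial-b a≢b))))
    stays-from-round1 : ∀ {c} → colouring 1 v ≡ c → isUncol c ≡ false → colouring (suc k) v ≡ c
    stays-from-round1 {c} c₁ coloured =
      subst (λ j → colouring j v ≡ c) (+-comm k 1) (trans (stays k 1 v (trans (cong isUncol c₁) coloured)) c₁)
    never : ∀ x → colouring 1 v ≡ contest x true → ⊥
    never true c₁ with trans (sym (stays-from-round1 c₁ refl)) p1ₖ
    ... | ()
    never false c₁ with trans (sym (stays-from-round1 c₁ refl)) p1ₖ
    ... | ()

  -- Player 1 floods a region R that Player 2 never borders, along decreasing vertex indices.
  module Flood (R : Fin N → Bool) (a≢b : toℕ a ≢ toℕ b) (Ra : T (R a)) (¬Rb : ¬ T (R b))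
    (predecessor : ∀ v → T (R v) → toℕ v ≢ toℕ a → Σ (Fin N) λ u → T (R u) × toℕ u < toℕ v × T (adj G v u))
    (shielded : ∀ k v u → T (R v) → toℕ v ≢ toℕ a → T (adj G v u) → colouring k u ≢ p2) where

    no-p2-neighbour : ∀ k v → T (R v) → toℕ v ≢ toℕ a → ownedNeighbour player₂ (colouring k) v ≡ false
    no-p2-neighbour k v Rv v≢a = ¬T⇒≡false λ owned →
      let (u , vu , p2u) = ownedNeighbour-elim player₂ (colouring k) v owned in shielded k v u Rv v≢a vu p2u

    uncol-or-p1 : ∀ k v → T (R v) → toℕ v ≢ toℕ a → colouring k v ≡ uncol ⊎ colouring k v ≡ p1
    uncol-or-p1 zero v Rv v≢a = inj₁ (initial-other v a≢b v≢a (λ v≡b → ¬Rb (subst (λ z → T (R z)) (toℕ-injective v≡b) Rv)))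
    uncol-or-p1 (suc k) v Rv v≢a with uncol-or-p1 k v Rv v≢a
    ... | inj₂ p1ₖ = inj₂ (trans (persists k v (cong isUncol p1ₖ)) p1ₖ)
    ... | inj₁ uncolₖ = without-p2 (ownedNeighbour player₁ (colouring k) v)
          (trans (colouring-suc k v) (trans (step-uncol (colouring k) v uncolₖ) (cong (contest _) (no-p2-neighbour k v Rv v≢a))))
      where
      without-p2 : ∀ x → colouring (suc k) v ≡ contest x false → colouring (suc k) v ≡ uncol ⊎ colouring (suc k) v ≡ p1
      without-p2 true  e = inj₂ e
      without-p2 false e = inj₁ e

    flood : ∀ k v → T (R v) → toℕ v ≤ k → colouring k v ≡ p1
    flood k v Rv v≤k with toℕ v ℕ.≟ toℕ a
    ... | yes v≡a = subst (λ z → colouring k z ≡ p1) (sym (toℕ-injective v≡a)) (a-coloured a≢b k)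
    flood zero v Rv v≤0 | no v≢a = let (u , _ , u<v , _) = predecessor v Rv v≢a in ⊥-elim (n≮0 (<-≤-trans u<v v≤0))
    flood (suc k) v Rv v≤k | no v≢a with uncol-or-p1 k v Rv v≢a
    ... | inj₂ p1ₖ = trans (persists k v (cong isUncol p1ₖ)) p1ₖ
    ... | inj₁ uncolₖ =
      let (u , Ru , u<v , vu) = predecessor v Rv v≢a
          p1-neighbour = ownedNeighbour-intro player₁ (colouring k) v u vu (flood k u Ru (≤-pred (≤-trans u<v v≤k)))
      in trans (colouring-suc k v) (trans (step-uncol (colouring k) v uncolₖ)
           (cong₂ contest p1-neighbour (no-p2-neighbour k v Rv v≢a)))

  gain-≤-count : (S : Fin N → Bool) → (∀ v → colouring N v ≡ p1 → T (S v)) → gainMatrix G a b ≤ count S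
  gain-≤-count S inS = subst (_≤ count S) (sym (countFin≡count (λ v → isP1 (colouring N v))))
    (sum-mono-≤ (λ v → indicator-mono (λ isp1 → inS v (owns-elim player₁ (colouring N v) isp1))))

  count-≤-gain : (R : Fin N → Bool) → (∀ v → T (R v) → colouring N v ≡ p1) → count R ≤ gainMatrix G a b
  count-≤-gain R flooded = subst (count R ≤_) (sym (countFin≡count (λ v → isP1 (colouring N v))))
    (sum-mono-≤ (λ v → indicator-mono (λ Rv → subst (λ c → T (isP1 c)) (sym (flooded v Rv)) tt)))


module TreeGains (k h : Data.Nat.ℕ) where

  open import Data.Nat using (ℕ; _≤_; _<_)
  open import Data.Nat.Properties using (≤-trans; ≤-<-trans; <⇒≤; n≢0⇒n>0)
  open import Data.Bool using (Bool; false; not; T)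
  open import Data.Fin using (Fin; toℕ; fromℕ<)
  open import Data.Fin.Properties using (toℕ<n; toℕ-fromℕ<)
  open import Data.Product using (_×_; _,_; proj₁; proj₂; Σ)
  open import Data.Sum using (_⊎_; inj₁; inj₂)
  open import Relation.Binary.PropositionalEquality
  open import Relation.Nullary using (¬_)
  open import Defs using (Graph; gainMatrix; parent; p1; p2)
  import Defs
  open FiniteSums
  open HeapTree k h

  G : Graph
  G = Defs.T m h

  A : Fin n → Fin n → ℕ
  A = gainMatrix G

  parentVertex : Fin n → Fin n
  parentVertex v = fromℕ< (≤-<-trans (parent-≤ (toℕ v)) (toℕ<n v))

  toℕ-parentVertex : ∀ v → toℕ (parentVertex v) ≡ parent m (toℕ v)
  toℕ-parentVertex v = toℕ-fromℕ< _

  towardsRoot : (P : ℕ → Bool) → ∀ v → 1 ≤ toℕ v → T (P (parent m (toℕ v))) →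
    Σ (Fin n) λ u → T (P (toℕ u)) × toℕ u < toℕ v × T (adjacent (toℕ v) (toℕ u))
  towardsRoot P v 1≤v Ppv =
    parentVertex v ,
    subst (λ z → T (P z)) (sym p≡) Ppv ,
    subst (_< toℕ v) (sym p≡) (parent-< (toℕ v) 1≤v) ,
    subst (λ z → T (adjacent (toℕ v) z)) (sym p≡) (adjacent-toParent (toℕ v) 1≤v)
    where p≡ = toℕ-parentVertex v

  gain-diagonal : ∀ a b → toℕ a ≡ toℕ b → A a b ≤ 0
  gain-diagonal a b a≡b = subst (A a b ≤_) (count-false {n})
    (gain-≤-count (λ _ → false) (confined player₁ (λ _ → false) (λ v → initial-diagonal v a≡b) (λ _ _ _ u∈∅ _ _ _ → u∈∅) n))
    where open Diffusion G a b

  -- The vertices Player 1 can never take: Player 2's start, and its neighbours that are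
  -- nobody's start.
  Blocked : Fin n → Fin n → ℕ → Set
  Blocked a b y = y ≡ toℕ b ⊎ (y ≢ toℕ a × y ≢ toℕ b × T (adjacent y (toℕ b)))

  blocked-never-p1 : ∀ a b → toℕ a ≢ toℕ b → ∀ v → Blocked a b (toℕ v) → ∀ j → Diffusion.colouring G a b j v ≢ p1
  blocked-never-p1 a b a≢b v (inj₁ v≡b) j = b-never-p1 a≢b j v v≡b
    where open Diffusion G a b
  blocked-never-p1 a b a≢b v (inj₂ (v≢a , v≢b , vb)) = neighbour-of-b-never-p1 v a≢b v≢a v≢b vb
    where open Diffusion G a b

  gain-≤-subtree : ∀ a b x → 1 ≤ x → T (inSubtree x (toℕ a)) → toℕ a ≢ toℕ b → Blocked a b (parent m x) →
    A a b ≤ count {n} (λ v → inSubtree x (toℕ v))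
  gain-≤-subtree a b x 1≤x a∈x a≢b blocked = gain-≤-count S (confined player₁ S start border n)
    where
    open Diffusion G a b
    S = λ (v : Fin n) → inSubtree x (toℕ v)
    start : ∀ v → colouring 0 v ≡ p1 → T (S v)
    start v p1₀ = subst (λ z → T (inSubtree x z)) (sym (initial-owner player₁ v p1₀)) a∈x
    border : ∀ u v → T (adjacent (toℕ v) (toℕ u)) → T (S u) → ¬ T (S v) → ∀ j → colouring j v ≢ p1
    border u v vu u∈x v∉x =
      let v≡px = proj₂ (edge-leaving-subtree x (toℕ u) (toℕ v) 1≤x (toℕ<n u) (toℕ<n v) (adjacent-sym (toℕ v) (toℕ u) vu) u∈x v∉x)
      in blocked-never-p1 a b a≢b v (subst (Blocked a b) (sym v≡px) blocked)

  gain-≤-outside : ∀ a b → 1 ≤ toℕ b → ¬ T (inSubtree (toℕ b) (toℕ a)) →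
    A a b ≤ count {n} (λ v → not (inSubtree (toℕ b) (toℕ v)))
  gain-≤-outside a b 1≤b a∉b = gain-≤-count S (confined player₁ S start border n)
    where
    open Diffusion G a b
    a≢b : toℕ a ≢ toℕ b
    a≢b a≡b = a∉b (subst (λ z → T (inSubtree (toℕ b) z)) (sym a≡b) (inSubtree-root (toℕ b) 1≤b (toℕ<n b)))
    S = λ (v : Fin n) → not (inSubtree (toℕ b) (toℕ v))
    start : ∀ v → colouring 0 v ≡ p1 → T (S v)
    start v p1₀ = ¬T⇒T-not (subst (λ z → ¬ T (inSubtree (toℕ b) z)) (sym (initial-owner player₁ v p1₀)) a∉b)
    border : ∀ u v → T (adjacent (toℕ v) (toℕ u)) → T (S u) → ¬ T (S v) → ∀ j → colouring j v ≢ p1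
    border u v vu u∉b ¬v∉b j = b-never-p1 a≢b j v
      (proj₁ (edge-leaving-subtree (toℕ b) (toℕ v) (toℕ u) 1≤b (toℕ<n v) (toℕ<n u) vu (¬T-not⇒T ¬v∉b) (T-not⇒¬T u∉b)))

  subtree-≤-gain : ∀ a b → 1 ≤ toℕ a → ¬ T (inSubtree (toℕ a) (toℕ b)) →
    count {n} (λ v → inSubtree (toℕ a) (toℕ v)) ≤ A a b
  subtree-≤-gain a b 1≤a b∉a = count-≤-gain R (λ v Rv → Flood.flood R a≢b a∈a b∉a predecessor shielded n v Rv (<⇒≤ (toℕ<n v)))
    where
    open Diffusion G a b
    c = toℕ a
    R = λ (v : Fin n) → inSubtree c (toℕ v)
    a∈a : T (R a)
    a∈a = inSubtree-root c 1≤a (toℕ<n a)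
    a≢b : c ≢ toℕ b
    a≢b a≡b = b∉a (subst (λ z → T (inSubtree c z)) a≡b a∈a)
    predecessor : ∀ v → T (R v) → toℕ v ≢ c → Σ (Fin n) λ u → T (R u) × toℕ u < toℕ v × T (adjacent (toℕ v) (toℕ u))
    predecessor v Rv v≢a = towardsRoot (inSubtree c) v (≤-trans 1≤a (inSubtree-≥ c (toℕ v) Rv))
      (inSubtree-parent c (toℕ v) 1≤a (toℕ<n v) Rv v≢a)
    p2-outside : ∀ j w → colouring j w ≡ p2 → T (not (inSubtree c (toℕ w)))
    p2-outside = confined player₂ (λ w → not (inSubtree c (toℕ w)))
      (λ w p2₀ → ¬T⇒T-not (subst (λ z → ¬ T (inSubtree c z)) (sym (initial-owner player₂ w p2₀)) b∉a))
      (λ u v vu u∉a ¬v∉a j → a-never-p2 a≢b j v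
        (proj₁ (edge-leaving-subtree c (toℕ v) (toℕ u) 1≤a (toℕ<n v) (toℕ<n u) vu (¬T-not⇒T ¬v∉a) (T-not⇒¬T u∉a))))
    shielded : ∀ j v u → T (R v) → toℕ v ≢ c → T (adjacent (toℕ v) (toℕ u)) → colouring j u ≢ p2
    shielded j v u Rv v≢a vu p2ᵤ =
      v≢a (proj₁ (edge-leaving-subtree c (toℕ v) (toℕ u) 1≤a (toℕ<n v) (toℕ<n u) vu Rv (T-not⇒¬T (p2-outside j u p2ᵤ))))

  outside-≤-gain : ∀ a b c → 1 ≤ c → c < nodes 1 → toℕ a ≡ 0 → T (inSubtree c (toℕ b)) →
    count {n} (λ v → not (inSubtree c (toℕ v))) ≤ A a b
  outside-≤-gain a b c 1≤c c<nodes1 a≡0 b∈c =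
    count-≤-gain R (λ v Rv → Flood.flood R a≢b a∉c (λ b∉c → T-not⇒¬T b∉c b∈c) predecessor shielded n v Rv (<⇒≤ (toℕ<n v)))
    where
    open Diffusion G a b
    R = λ (v : Fin n) → not (inSubtree c (toℕ v))
    a∉c : T (R a)
    a∉c = ¬T⇒T-not (subst (λ z → ¬ T (inSubtree c z)) (sym a≡0) (inSubtree-0 c 1≤c))
    a≢b : toℕ a ≢ toℕ b
    a≢b a≡b = T-not⇒¬T a∉c (subst (λ z → T (inSubtree c z)) (sym a≡b) b∈c)
    parent-c≡a : parent m c ≡ toℕ a
    parent-c≡a = trans (parent-depth1 c 1≤c c<nodes1) (sym a≡0)
    predecessor : ∀ v → T (R v) → toℕ v ≢ toℕ a → Σ (Fin n) λ u → T (R u) × toℕ u < toℕ v × T (adjacent (toℕ v) (toℕ u))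
    predecessor v Rv v≢a = towardsRoot (λ z → not (inSubtree c z)) v 1≤v
      (¬T⇒T-not (λ pv∈c → T-not⇒¬T Rv (inSubtree-child c (toℕ v) 1≤c 1≤v (toℕ<n v) pv∈c)))
      where 1≤v = n≢0⇒n>0 (λ v≡0 → v≢a (trans v≡0 (sym a≡0)))
    leaves-through-a : ∀ u v → T (adjacent (toℕ v) (toℕ u)) → T (inSubtree c (toℕ u)) → ¬ T (inSubtree c (toℕ v)) → toℕ v ≡ toℕ a
    leaves-through-a u v vu u∈c v∉c = trans (proj₂ (edge-leaving-subtree c (toℕ u) (toℕ v) 1≤c (toℕ<n u) (toℕ<n v)
      (adjacent-sym (toℕ v) (toℕ u) vu) u∈c v∉c)) parent-c≡a
    p2-inside : ∀ j w → colouring j w ≡ p2 → T (inSubtree c (toℕ w))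
    p2-inside = confined player₂ (λ w → inSubtree c (toℕ w))
      (λ w p2₀ → subst (λ z → T (inSubtree c z)) (sym (initial-owner player₂ w p2₀)) b∈c)
      (λ u v vu u∈c v∉c j → a-never-p2 a≢b j v (leaves-through-a u v vu u∈c v∉c))
    shielded : ∀ j v u → T (R v) → toℕ v ≢ toℕ a → T (adjacent (toℕ v) (toℕ u)) → colouring j u ≢ p2
    shielded j v u Rv v≢a vu p2ᵤ = v≢a (leaves-through-a u v vu (p2-inside j u p2ᵤ) (T-not⇒¬T Rv))


module StrategyBounds (k h′ : Data.Nat.ℕ) where

  open import Data.Nat as ℕ using (ℕ; zero; suc; _+_; _*_; _∸_; _^_; _≤_; _<_; z≤n; s≤s)
  open import Data.Nat.Properties
  open import Data.Bool using (not; T)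
  open import Data.Fin using (Fin; toℕ)
  open import Data.Fin.Properties using (toℕ<n)
  open import Data.Product using (_×_; _,_; proj₁; proj₂)
  open import Data.Sum using (inj₁; inj₂)
  open import Relation.Binary.PropositionalEquality
  open import Relation.Nullary using (¬_; yes; no; contradiction)
  open import Relation.Binary using (tri<; tri≈; tri>)
  open import Data.Nat.Solver using (module +-*-Solver)
  open +-*-Solver using (solve; _:+_; _:*_; _:=_; con)
  open import Defs using (depth; parent)
  open FiniteSums
  open HeapTree k (suc h′)
  open TreeGains k (suc h′)

  -- s and s₂ are the sizes of the subtrees hanging from a vertex of depth 1 and of depth 2.
  s s₂ : ℕ
  s = sumBelow (suc h′) (m ^_)
  s₂ = sumBelow h′ (m ^_)

  nodes1≤n : nodes 1 ≤ n
  nodes1≤n = nodes-mono {1} {suc h′} (s≤s z≤n)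

  data Depth (v : ℕ) : Set where
    root   : v ≡ 0 → Depth v
    depth1 : 1 ≤ v → v < nodes 1 → Depth v
    deep   : nodes 1 ≤ v → Depth v

  depthOf : ∀ v → Depth v
  depthOf zero = root refl
  depthOf (suc v) with suc v ℕ.<? nodes 1
  ... | yes v<nodes1 = depth1 (s≤s z≤n) v<nodes1
  ... | no v≮nodes1 = deep (≮⇒≥ v≮nodes1)

  byDepthℕ : ℕ → ℕ → ℕ → ℕ
  byDepthℕ r d v with depth m v
  ... | 0 = r
  ... | 1 = d
  ... | suc (suc _) = 0

  byDepthℕ-root : ∀ r d {v} → v ≡ 0 → byDepthℕ r d v ≡ r
  byDepthℕ-root r d refl = refl

  byDepthℕ-depth1 : ∀ r d v → 1 ≤ v → v < nodes 1 → byDepthℕ r d v ≡ d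
  byDepthℕ-depth1 r d v 1≤v v<nodes1 rewrite depth-1 v 1≤v v<nodes1 = refl

  byDepthℕ-deep : ∀ r d v → nodes 1 ≤ v → byDepthℕ r d v ≡ 0
  byDepthℕ-deep r d v nodes1≤v with depth-≥2 v nodes1≤v
  ... | (_ , depth≡) rewrite depth≡ = refl

  private
    atRoot atDepth1 : ℕ → ℕ
    atRoot v = indicator (inRange 0 1 v)
    atDepth1 v = indicator (inRange 1 (1 + m) v)

    byDepthℕ-indicators : ∀ r d v → byDepthℕ r d v ≡ r * atRoot v + d * atDepth1 v
    byDepthℕ-indicators r d v with depthOf v
    ... | root refl = sym (trans (cong₂ _+_ (*-identityʳ r) (*-zeroʳ d)) (+-identityʳ r))
    ... | depth1 1≤v v<nodes1 rewrite byDepthℕ-depth1 r d v 1≤v v<nodes1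
          | indicator-inRange-above 0 1 v 1≤v | indicator-inRange-inside 1 (1 + m) v 1≤v (subst (v <_) nodes-1 v<nodes1)
          = sym (trans (cong (_+ d * 1) (*-zeroʳ r)) (*-identityʳ d))
    ... | deep nodes1≤v rewrite byDepthℕ-deep r d v nodes1≤v
          | indicator-inRange-above 0 1 v (≤-trans (s≤s z≤n) nodes1≤v) | indicator-inRange-above 1 (1 + m) v (subst (_≤ v) nodes-1 nodes1≤v)
          = sym (cong₂ _+_ (*-zeroʳ r) (*-zeroʳ d))

  sum-byDepthℕ : ∀ r d → sum {n} (λ i → byDepthℕ r d (toℕ i)) ≡ r + d * m
  sum-byDepthℕ r d = begin
    sum {n} (λ i → byDepthℕ r d (toℕ i))
      ≡⟨ sum-cong-≗ {n} (λ i → byDepthℕ-indicators r d (toℕ i)) ⟩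
    sum {n} (λ i → r * atRoot (toℕ i) + d * atDepth1 (toℕ i))
      ≡⟨ ∑-distrib-+ {n} (λ i → r * atRoot (toℕ i)) (λ i → d * atDepth1 (toℕ i)) ⟩
    sum {n} (λ i → r * atRoot (toℕ i)) + sum {n} (λ i → d * atDepth1 (toℕ i))
      ≡⟨ sym (cong₂ _+_ (*-distribˡ-sum {n} r (λ i → atRoot (toℕ i))) (*-distribˡ-sum {n} d (λ i → atDepth1 (toℕ i)))) ⟩
    r * count {n} (λ i → inRange 0 1 (toℕ i)) + d * count {n} (λ i → inRange 1 (1 + m) (toℕ i))
      ≡⟨ cong₂ (λ x y → r * x + d * y) (count-inRange-inside n 0 1 (≤-trans (s≤s z≤n) nodes1≤n))
                                        (count-inRange-inside n 1 m (subst (_≤ n) nodes-1 nodes1≤n)) ⟩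
    r * 1 + d * m
      ≡⟨ cong (_+ d * m) (*-identityʳ r) ⟩
    r + d * m ∎
    where open ≡-Reasoning

  at : ℕ → ℕ → ℕ
  at c v = indicator (inRange c (c + 1) v)

  at-self : ∀ c → at c c ≡ 1
  at-self c = indicator-inRange-inside c (c + 1) c ≤-refl (subst (c <_) (+-comm 1 c) ≤-refl)

  at-other : ∀ c v → v ≢ c → at c v ≡ 0
  at-other c v v≢c with <-cmp v c
  ... | tri< v<c _ _ = indicator-inRange-below c (c + 1) v v<c
  ... | tri≈ _ v≡c _ = contradiction v≡c v≢c
  ... | tri> _ _ c<v = indicator-inRange-above c (c + 1) v (subst (_≤ v) (+-comm 1 c) c<v)

  *-at-other : ∀ a c v → v ≢ c → a * at c v ≡ 0
  *-at-other a c v v≢c = trans (cong (a *_) (at-other c v v≢c)) (*-zeroʳ a)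

  sum-at : ∀ a c → c < n → sum {n} (λ i → a * at c (toℕ i)) ≡ a
  sum-at a c c<n = begin
    sum {n} (λ i → a * at c (toℕ i))
      ≡⟨ sym (*-distribˡ-sum {n} a (λ i → at c (toℕ i))) ⟩
    a * count {n} (λ i → inRange c (c + 1) (toℕ i)) ≡⟨ cong (a *_) (count-inRange-inside n c 1 (subst (_≤ n) (+-comm 1 c) c<n)) ⟩
    a * 1
      ≡⟨ *-identityʳ a ⟩
    a ∎
    where open ≡-Reasoning

  count-outside-depth1 : ∀ c → 1 ≤ c → c < nodes 1 → count {n} (λ v → not (inSubtree c (toℕ v))) ≡ n ∸ s
  count-outside-depth1 c 1≤c c<nodes1 = begin
    count {n} (λ v → not (inSubtree c (toℕ v)))
      ≡⟨ sym (m+n∸n≡m _ s) ⟩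
    count {n} (λ v → not (inSubtree c (toℕ v))) + s ∸ s
      ≡⟨ cong (λ z → count {n} (λ v → not (inSubtree c (toℕ v))) + z ∸ s) (sym (count-subtree-depth1 c 1≤c c<nodes1)) ⟩
    count {n} (λ v → not (inSubtree c (toℕ v))) + count {n} (λ v → inSubtree c (toℕ v)) ∸ s
      ≡⟨ cong (_∸ s) (count-not {n} (λ v → inSubtree c (toℕ v))) ⟩
    n ∸ s ∎
    where open ≡-Reasoning

  diagonal-term : ∀ i j y → toℕ i ≡ toℕ j → A i j * y ≡ 0
  diagonal-term i j y i≡j = subst (λ z → z * y ≡ 0) (sym (n≤0⇒n≡0 (gain-diagonal i j i≡j))) refl

  subtree-depth1-≤-gain : ∀ i j → 1 ≤ toℕ i → toℕ i < nodes 1 → ¬ T (inSubtree (toℕ i) (toℕ j)) → s ≤ A i j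
  subtree-depth1-≤-gain i j 1≤i i<nodes1 j∉i =
    subst (_≤ A i j) (count-subtree-depth1 (toℕ i) 1≤i i<nodes1) (subtree-≤-gain i j 1≤i j∉i)

  outside-depth1-≤-gain : ∀ i j c → 1 ≤ c → c < nodes 1 → toℕ i ≡ 0 → T (inSubtree c (toℕ j)) → n ∸ s ≤ A i j
  outside-depth1-≤-gain i j c 1≤c c<nodes1 i≡0 j∈c =
    subst (_≤ A i j) (count-outside-depth1 c 1≤c c<nodes1) (outside-≤-gain i j c 1≤c c<nodes1 i≡0 j∈c)

  gain-≤-outside-depth1 : ∀ i j → 1 ≤ toℕ j → toℕ j < nodes 1 → toℕ i ≡ 0 → A i j ≤ n ∸ s
  gain-≤-outside-depth1 i j 1≤j j<nodes1 i≡0 = subst (A i j ≤_) (count-outside-depth1 (toℕ j) 1≤j j<nodes1)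
    (gain-≤-outside i j 1≤j (λ i∈j → inSubtree-0 (toℕ j) 1≤j (subst (λ z → T (inSubtree (toℕ j) z)) i≡0 i∈j)))

  gain-≤-subtree-depth1 : ∀ i j x → 1 ≤ x → x < nodes 1 → T (inSubtree x (toℕ i)) → toℕ i ≢ toℕ j →
    Blocked i j (parent m x) → A i j ≤ s
  gain-≤-subtree-depth1 i j x 1≤x x<nodes1 i∈x i≢j blocked =
    subst (A i j ≤_) (count-subtree-depth1 x 1≤x x<nodes1) (gain-≤-subtree i j x 1≤x i∈x i≢j blocked)

  gain-≤-subtree-depth2 : ∀ i j x → nodes 1 ≤ x → x < nodes 2 → T (inSubtree x (toℕ i)) → toℕ i ≢ toℕ j →
    Blocked i j (parent m x) → A i j ≤ s₂
  gain-≤-subtree-depth2 i j x nodes1≤x x<nodes2 i∈x i≢j blocked =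
    ≤-trans (gain-≤-subtree i j x (≤-trans (s≤s z≤n) nodes1≤x) i∈x i≢j blocked)
            (count-subtree-depth2-≤ x h′ refl nodes1≤x x<nodes2)

  private
    positive≢zero : ∀ {x y} → 1 ≤ x → y ≡ 0 → y ≢ x
    positive≢zero 1≤x y≡0 y≡x = <⇒≢ 1≤x (trans (sym y≡0) y≡x)

    deep≢depth1 : ∀ {x y} → x < nodes 1 → nodes 1 ≤ y → y ≢ x
    deep≢depth1 x<nodes1 nodes1≤y y≡x = <⇒≱ x<nodes1 (subst (nodes 1 ≤_) y≡x nodes1≤y)

  module Columns (r w : ℕ) where

    weighted : Fin n → Fin n → ℕ
    weighted i j = byDepthℕ r w (toℕ i) * A i j

    column-root-pointwise : ∀ j → toℕ j ≡ 0 → ∀ i → byDepthℕ 0 (w * s) (toℕ i) ≤ weighted i j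
    column-root-pointwise j j≡0 i with depthOf (toℕ i)
    ... | root i≡0 = ≤-trans (≤-reflexive (byDepthℕ-root 0 (w * s) i≡0)) z≤n
    ... | deep nodes1≤i = ≤-trans (≤-reflexive (byDepthℕ-deep 0 (w * s) (toℕ i) nodes1≤i)) z≤n
    ... | depth1 1≤i i<nodes1 = begin
        byDepthℕ 0 (w * s) (toℕ i)
          ≡⟨ byDepthℕ-depth1 0 (w * s) (toℕ i) 1≤i i<nodes1 ⟩
        w * s
          ≤⟨ *-monoʳ-≤ w (subtree-depth1-≤-gain i j 1≤i i<nodes1 j∉i) ⟩
        w * A i j
          ≡⟨ cong (_* A i j) (sym (byDepthℕ-depth1 r w (toℕ i) 1≤i i<nodes1)) ⟩
        weighted i j ∎
      where
      open ≤-Reasoning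
      j∉i : ¬ T (inSubtree (toℕ i) (toℕ j))
      j∉i j∈i = inSubtree-0 (toℕ i) 1≤i (subst (λ z → T (inSubtree (toℕ i) z)) j≡0 j∈i)

    column-pointwise : ∀ j c → 1 ≤ c → c < nodes 1 → T (inSubtree c (toℕ j)) → ∀ i →
      byDepthℕ (r * (n ∸ s)) (w * s) (toℕ i) ≤ weighted i j + w * s * at c (toℕ i)
    column-pointwise j c 1≤c c<nodes1 j∈c i with depthOf (toℕ i)
    ... | root i≡0 = begin
        byDepthℕ (r * (n ∸ s)) (w * s) (toℕ i)
          ≡⟨ byDepthℕ-root _ _ i≡0 ⟩
        r * (n ∸ s)
          ≤⟨ *-monoʳ-≤ r (outside-depth1-≤-gain i j c 1≤c c<nodes1 i≡0 j∈c) ⟩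
        r * A i j
          ≡⟨ cong (_* A i j) (sym (byDepthℕ-root r w i≡0)) ⟩
        weighted i j
          ≤⟨ m≤m+n _ _ ⟩
        weighted i j + w * s * at c (toℕ i) ∎
      where open ≤-Reasoning
    ... | deep nodes1≤i = ≤-trans (≤-reflexive (byDepthℕ-deep _ _ (toℕ i) nodes1≤i)) z≤n
    ... | depth1 1≤i i<nodes1 with toℕ i ℕ.≟ c
    ...   | yes i≡c = begin
        byDepthℕ (r * (n ∸ s)) (w * s) (toℕ i)
          ≡⟨ byDepthℕ-depth1 _ _ (toℕ i) 1≤i i<nodes1 ⟩
        w * s
          ≡⟨ sym (*-identityʳ (w * s)) ⟩
        w * s * 1
          ≡⟨ cong (w * s *_) (sym (trans (cong (at c) i≡c) (at-self c))) ⟩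
        w * s * at c (toℕ i)
          ≤⟨ m≤n+m _ _ ⟩
        weighted i j + w * s * at c (toℕ i) ∎
      where open ≤-Reasoning
    ...   | no i≢c = begin
        byDepthℕ (r * (n ∸ s)) (w * s) (toℕ i)
          ≡⟨ byDepthℕ-depth1 _ _ (toℕ i) 1≤i i<nodes1 ⟩
        w * s
          ≤⟨ *-monoʳ-≤ w (subtree-depth1-≤-gain i j 1≤i i<nodes1 j∉i) ⟩
        w * A i j
          ≡⟨ cong (_* A i j) (sym (byDepthℕ-depth1 r w (toℕ i) 1≤i i<nodes1)) ⟩
        weighted i j
          ≤⟨ m≤m+n _ _ ⟩
        weighted i j + w * s * at c (toℕ i) ∎
      where
      open ≤-Reasoning
      j∉i : ¬ T (inSubtree (toℕ i) (toℕ j))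
      j∉i j∈i = i≢c (depth1-ancestor-unique (toℕ i) c (toℕ j) 1≤i i<nodes1 1≤c c<nodes1 j∈i j∈c)

    -- The root column is handled separately; every other column loses the term w * s at
    -- the depth-1 ancestor of j, which the balance r (n - s) = w s makes up for.
    column-≥ : r * (n ∸ s) ≡ w * s → ∀ j → w * s * m ≤ sum {n} (λ i → weighted i j)
    column-≥ balanced j with toℕ j ℕ.≟ 0
    ... | yes j≡0 = subst (_≤ sum {n} (λ i → weighted i j)) (sum-byDepthℕ 0 (w * s)) (sum-mono-≤ {n} (column-root-pointwise j j≡0))
    ... | no j≢0 with depth1-ancestor (toℕ j) (n≢0⇒n>0 j≢0) (toℕ<n j)
    ...   | c , 1≤c , c<nodes1 , j∈c = +-cancelʳ-≤ (w * s) _ _ (begin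
        w * s * m + w * s
          ≡⟨ +-comm (w * s * m) (w * s) ⟩
        w * s + w * s * m
          ≡⟨ cong (_+ w * s * m) (sym balanced) ⟩
        r * (n ∸ s) + w * s * m
          ≡⟨ sym (sum-byDepthℕ (r * (n ∸ s)) (w * s)) ⟩
        sum {n} (λ i → byDepthℕ (r * (n ∸ s)) (w * s) (toℕ i))
          ≤⟨ sum-mono-≤ {n} (column-pointwise j c 1≤c c<nodes1 j∈c) ⟩
        sum {n} (λ i → weighted i j + w * s * at c (toℕ i))
          ≡⟨ ∑-distrib-+ {n} (λ i → weighted i j) (λ i → w * s * at c (toℕ i)) ⟩
        sum {n} (λ i → weighted i j) + sum {n} (λ i → w * s * at c (toℕ i))
          ≡⟨ cong (sum {n} (λ i → weighted i j) +_) (sum-at (w * s) c (<-≤-trans c<nodes1 nodes1≤n)) ⟩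
        sum {n} (λ i → weighted i j) + w * s                    ∎)
      where open ≤-Reasoning

  module Rows (α u : ℕ) where

    weighted : Fin n → Fin n → ℕ
    weighted i j = A i j * byDepthℕ α u (toℕ j)

    weighted-deep : ∀ i j → nodes 1 ≤ toℕ j → weighted i j ≡ 0
    weighted-deep i j nodes1≤j = trans (cong (A i j *_) (byDepthℕ-deep α u (toℕ j) nodes1≤j)) (*-zeroʳ (A i j))

    drop-at : ∀ i j a c → toℕ j ≢ c → weighted i j + a * at c (toℕ j) ≡ weighted i j
    drop-at i j a c j≢c = trans (cong (weighted i j +_) (*-at-other a c (toℕ j) j≢c)) (+-identityʳ _)

    row-root-pointwise : ∀ i → toℕ i ≡ 0 → ∀ j → weighted i j ≤ byDepthℕ 0 (u * (n ∸ s)) (toℕ j)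
    row-root-pointwise i i≡0 j with depthOf (toℕ j)
    ... | root j≡0 = ≤-trans (≤-reflexive (diagonal-term i j _ (trans i≡0 (sym j≡0)))) z≤n
    ... | deep nodes1≤j = ≤-trans (≤-reflexive (weighted-deep i j nodes1≤j)) z≤n
    ... | depth1 1≤j j<nodes1 = begin
        A i j * byDepthℕ α u (toℕ j)
          ≡⟨ cong (A i j *_) (byDepthℕ-depth1 α u (toℕ j) 1≤j j<nodes1) ⟩
        A i j * u
          ≤⟨ *-monoˡ-≤ u (gain-≤-outside-depth1 i j 1≤j j<nodes1 i≡0) ⟩
        (n ∸ s) * u
          ≡⟨ *-comm (n ∸ s) u ⟩
        u * (n ∸ s)
          ≡⟨ sym (byDepthℕ-depth1 0 _ (toℕ j) 1≤j j<nodes1) ⟩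
        byDepthℕ 0 (u * (n ∸ s)) (toℕ j) ∎
      where open ≤-Reasoning

    row-root : ∀ i → toℕ i ≡ 0 → sum {n} (λ j → weighted i j) ≤ u * (n ∸ s) * m
    row-root i i≡0 =
      subst (sum {n} (λ j → weighted i j) ≤_) (sum-byDepthℕ 0 (u * (n ∸ s))) (sum-mono-≤ {n} (row-root-pointwise i i≡0))

    row-depth1-pointwise : ∀ i → 1 ≤ toℕ i → toℕ i < nodes 1 → ∀ j →
      weighted i j + u * s * at (toℕ i) (toℕ j) ≤ byDepthℕ (α * s) (u * s) (toℕ j)
    row-depth1-pointwise i 1≤i i<nodes1 j with depthOf (toℕ j)
    ... | root j≡0 = begin
        weighted i j + u * s * at (toℕ i) (toℕ j)
          ≡⟨ drop-at i j (u * s) (toℕ i) (positive≢zero 1≤i j≡0) ⟩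
        A i j * byDepthℕ α u (toℕ j)
          ≡⟨ cong (A i j *_) (byDepthℕ-root α u j≡0) ⟩
        A i j * α
          ≤⟨ *-monoˡ-≤ α (gain-≤-subtree-depth1 i j (toℕ i) 1≤i i<nodes1 i∈i
              (λ i≡j → positive≢zero 1≤i j≡0 (sym i≡j))
              (inj₁ (trans (parent-depth1 (toℕ i) 1≤i i<nodes1) (sym j≡0)))) ⟩
        s * α
          ≡⟨ trans (*-comm s α) (sym (byDepthℕ-root _ _ j≡0)) ⟩
        byDepthℕ (α * s) (u * s) (toℕ j) ∎
      where
      open ≤-Reasoning
      i∈i = inSubtree-root (toℕ i) 1≤i (toℕ<n i)
    ... | deep nodes1≤j = ≤-trans (≤-reflexive (cong₂ _+_ (weighted-deep i j nodes1≤j)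
            (*-at-other (u * s) (toℕ i) (toℕ j) (deep≢depth1 i<nodes1 nodes1≤j)))) z≤n
    ... | depth1 1≤j j<nodes1 with toℕ j ℕ.≟ toℕ i
    ...   | yes j≡i = begin
        weighted i j + u * s * at (toℕ i) (toℕ j)
          ≡⟨ cong₂ _+_ (diagonal-term i j _ (sym j≡i)) (cong (u * s *_) (trans (cong (at (toℕ i)) j≡i) (at-self (toℕ i)))) ⟩
        u * s * 1
          ≡⟨ *-identityʳ _ ⟩
        u * s
          ≡⟨ sym (byDepthℕ-depth1 _ _ (toℕ j) 1≤j j<nodes1) ⟩
        byDepthℕ (α * s) (u * s) (toℕ j) ∎
      where open ≤-Reasoning
    ...   | no j≢i = begin
        weighted i j + u * s * at (toℕ i) (toℕ j)
          ≡⟨ drop-at i j (u * s) (toℕ i) j≢i ⟩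
        A i j * byDepthℕ α u (toℕ j)
          ≡⟨ cong (A i j *_) (byDepthℕ-depth1 α u (toℕ j) 1≤j j<nodes1) ⟩
        A i j * u
          ≤⟨ *-monoˡ-≤ u (gain-≤-subtree-depth1 i j (toℕ i) 1≤i i<nodes1
              (inSubtree-root (toℕ i) 1≤i (toℕ<n i)) (λ i≡j → j≢i (sym i≡j)) (inj₂ blocked)) ⟩
        s * u
          ≡⟨ trans (*-comm s u) (sym (byDepthℕ-depth1 _ _ (toℕ j) 1≤j j<nodes1)) ⟩
        byDepthℕ (α * s) (u * s) (toℕ j) ∎
      where
      open ≤-Reasoning
      parent≡0 = parent-depth1 (toℕ i) 1≤i i<nodes1
      blocked : parent m (toℕ i) ≢ toℕ i × parent m (toℕ i) ≢ toℕ j × T (adjacent (parent m (toℕ i)) (toℕ j))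
      blocked = positive≢zero 1≤i parent≡0 , positive≢zero 1≤j parent≡0 ,
                subst (λ z → T (adjacent z (toℕ j))) (sym parent≡0) (adjacent-root-depth1 (toℕ j) 1≤j j<nodes1)

    row-depth1 : ∀ i → 1 ≤ toℕ i → toℕ i < nodes 1 → sum {n} (λ j → weighted i j) + u * s ≤ α * s + u * s * m
    row-depth1 i 1≤i i<nodes1 = begin
      sum {n} (λ j → weighted i j) + u * s
        ≡⟨ cong (sum {n} (λ j → weighted i j) +_) (sym (sum-at (u * s) (toℕ i) (toℕ<n i))) ⟩
      sum {n} (λ j → weighted i j) + sum {n} (λ j → u * s * at (toℕ i) (toℕ j))
        ≡⟨ sym (∑-distrib-+ {n} (λ j → weighted i j) _) ⟩
      sum {n} (λ j → weighted i j + u * s * at (toℕ i) (toℕ j))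
        ≤⟨ sum-mono-≤ {n} (row-depth1-pointwise i 1≤i i<nodes1) ⟩
      sum {n} (λ j → byDepthℕ (α * s) (u * s) (toℕ j))
        ≡⟨ sum-byDepthℕ (α * s) (u * s) ⟩
      α * s + u * s * m ∎
      where open ≤-Reasoning

    module DeepRow (i : Fin n) (g : ℕ) (nodes1≤g : nodes 1 ≤ g) (g<nodes2 : g < nodes 2)
      (i∈g : T (inSubtree g (toℕ i))) (i∈c : T (inSubtree (parent m g) (toℕ i))) where

      c : ℕ
      c = parent m g

      1≤c : 1 ≤ c
      1≤c = proj₁ (parent-depth2 g nodes1≤g g<nodes2)

      c<nodes1 : c < nodes 1
      c<nodes1 = proj₂ (parent-depth2 g nodes1≤g g<nodes2)

      nodes1≤i : nodes 1 ≤ toℕ i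
      nodes1≤i = ≤-trans nodes1≤g (inSubtree-≥ g (toℕ i) i∈g)

      bound : ℕ → ℕ
      bound v = byDepthℕ (α * s₂) (u * s) v + u * s₂ * at c v

      at-root : ∀ j → toℕ j ≡ 0 → weighted i j + u * s * at c (toℕ j) ≤ bound (toℕ j)
      at-root j j≡0 = begin
        weighted i j + u * s * at c (toℕ j)
          ≡⟨ drop-at i j (u * s) c (positive≢zero 1≤c j≡0) ⟩
        A i j * byDepthℕ α u (toℕ j)
          ≡⟨ cong (A i j *_) (byDepthℕ-root α u j≡0) ⟩
        A i j * α
          ≤⟨ *-monoˡ-≤ α (gain-≤-subtree-depth2 i j g nodes1≤g g<nodes2 i∈g
              (λ i≡j → positive≢zero (≤-trans (s≤s z≤n) nodes1≤i) j≡0 (sym i≡j)) (inj₂ blocked)) ⟩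
        s₂ * α
          ≡⟨ trans (*-comm s₂ α) (sym (byDepthℕ-root _ _ j≡0)) ⟩
        byDepthℕ (α * s₂) (u * s) (toℕ j)
          ≤⟨ m≤m+n _ _ ⟩
        bound (toℕ j) ∎
        where
        open ≤-Reasoning
        blocked : c ≢ toℕ i × c ≢ toℕ j × T (adjacent c (toℕ j))
        blocked = (λ c≡i → <⇒≢ (<-≤-trans c<nodes1 nodes1≤i) c≡i) , (λ c≡j → positive≢zero 1≤c j≡0 (sym c≡j)) ,
                  subst (λ z → T (adjacent c z)) (trans (parent-depth1 c 1≤c c<nodes1) (sym j≡0)) (adjacent-toParent c 1≤c)

      at-c : ∀ j → 1 ≤ toℕ j → toℕ j < nodes 1 → toℕ j ≡ c → weighted i j + u * s * at c (toℕ j) ≤ bound (toℕ j)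
      at-c j 1≤j j<nodes1 j≡c = begin
        weighted i j + u * s * at c (toℕ j)
          ≡⟨ cong₂ (λ x y → A i j * x + u * s * y) (byDepthℕ-depth1 α u (toℕ j) 1≤j j<nodes1) at-c≡1 ⟩
        A i j * u + u * s * 1
          ≤⟨ +-monoˡ-≤ (u * s * 1) (*-monoˡ-≤ u (gain-≤-subtree-depth2 i j g nodes1≤g g<nodes2 i∈g
              (λ i≡j → deep≢depth1 j<nodes1 nodes1≤i i≡j) (inj₁ (sym j≡c)))) ⟩
        s₂ * u + u * s * 1
          ≡⟨ solve 3 (λ a u b → a :* u :+ u :* b :* con 1 := u :* b :+ u :* a :* con 1) refl s₂ u s ⟩
        u * s + u * s₂ * 1
          ≡⟨ cong₂ (λ x y → x + u * s₂ * y) (sym (byDepthℕ-depth1 _ _ (toℕ j) 1≤j j<nodes1)) (sym at-c≡1) ⟩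
        bound (toℕ j) ∎
        where
        open ≤-Reasoning
        at-c≡1 = trans (cong (at c) j≡c) (at-self c)

      at-other-depth1 : ∀ j → 1 ≤ toℕ j → toℕ j < nodes 1 → toℕ j ≢ c → weighted i j + u * s * at c (toℕ j) ≤ bound (toℕ j)
      at-other-depth1 j 1≤j j<nodes1 j≢c = begin
        weighted i j + u * s * at c (toℕ j)
          ≡⟨ drop-at i j (u * s) c j≢c ⟩
        A i j * byDepthℕ α u (toℕ j)
          ≡⟨ cong (A i j *_) (byDepthℕ-depth1 α u (toℕ j) 1≤j j<nodes1) ⟩
        A i j * u
          ≤⟨ *-monoˡ-≤ u (gain-≤-subtree-depth1 i j c 1≤c c<nodes1 i∈c
              (λ i≡j → deep≢depth1 j<nodes1 nodes1≤i i≡j) (inj₂ blocked)) ⟩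
        s * u
          ≡⟨ trans (*-comm s u) (sym (byDepthℕ-depth1 _ _ (toℕ j) 1≤j j<nodes1)) ⟩
        byDepthℕ (α * s₂) (u * s) (toℕ j)
          ≤⟨ m≤m+n _ _ ⟩
        bound (toℕ j) ∎
        where
        open ≤-Reasoning
        parent≡0 = parent-depth1 c 1≤c c<nodes1
        blocked : parent m c ≢ toℕ i × parent m c ≢ toℕ j × T (adjacent (parent m c) (toℕ j))
        blocked = positive≢zero (≤-trans (s≤s z≤n) nodes1≤i) parent≡0 , positive≢zero 1≤j parent≡0 ,
                  subst (λ z → T (adjacent z (toℕ j))) (sym parent≡0) (adjacent-root-depth1 (toℕ j) 1≤j j<nodes1)

      row-deep-pointwise : ∀ j → weighted i j + u * s * at c (toℕ j) ≤ bound (toℕ j)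
      row-deep-pointwise j with depthOf (toℕ j)
      ... | root j≡0 = at-root j j≡0
      ... | deep nodes1≤j = ≤-trans (≤-reflexive (cong₂ _+_ (weighted-deep i j nodes1≤j)
              (*-at-other (u * s) c (toℕ j) (deep≢depth1 c<nodes1 nodes1≤j)))) z≤n
      ... | depth1 1≤j j<nodes1 with toℕ j ℕ.≟ c
      ...   | yes j≡c = at-c j 1≤j j<nodes1 j≡c
      ...   | no j≢c = at-other-depth1 j 1≤j j<nodes1 j≢c

      row-deep : sum {n} (λ j → weighted i j) + u * s ≤ α * s₂ + u * s * m + u * s₂
      row-deep = begin
        sum {n} (λ j → weighted i j) + u * s
          ≡⟨ cong (sum {n} (λ j → weighted i j) +_) (sym (sum-at (u * s) c c<n)) ⟩
        sum {n} (λ j → weighted i j) + sum {n} (λ j → u * s * at c (toℕ j))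
          ≡⟨ sym (∑-distrib-+ {n} (λ j → weighted i j) _) ⟩
        sum {n} (λ j → weighted i j + u * s * at c (toℕ j))
          ≤⟨ sum-mono-≤ {n} row-deep-pointwise ⟩
        sum {n} (λ j → byDepthℕ (α * s₂) (u * s) (toℕ j) + u * s₂ * at c (toℕ j))
          ≡⟨ ∑-distrib-+ {n} (λ j → byDepthℕ (α * s₂) (u * s) (toℕ j)) _ ⟩
        sum {n} (λ j → byDepthℕ (α * s₂) (u * s) (toℕ j)) + sum {n} (λ j → u * s₂ * at c (toℕ j))
          ≡⟨ cong₂ _+_ (sum-byDepthℕ (α * s₂) (u * s)) (sum-at (u * s₂) c c<n) ⟩
        α * s₂ + u * s * m + u * s₂ ∎
        where
        open ≤-Reasoning
        c<n = <-≤-trans c<nodes1 nodes1≤n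

    row-deep : ∀ i → nodes 1 ≤ toℕ i → sum {n} (λ j → weighted i j) + u * s ≤ α * s₂ + u * s * m + u * s₂
    row-deep i nodes1≤i with depth2-ancestor (toℕ i) nodes1≤i (toℕ<n i)
    ... | g , nodes1≤g , g<nodes2 , i∈g , i∈c = DeepRow.row-deep i g nodes1≤g g<nodes2 i∈g i∈c


-- Everything is expressed through k = m - 1 and s = 1 + m + ... + m^(h-1), the size of a
-- subtree hanging from a depth-1 vertex: then m^h = k s + 1 and n = m s + 1.
module Arithmetic (k s : Data.Nat.ℕ) where

  open import Data.Nat using (ℕ; suc; _+_; _*_; _∸_; _≤_)
  open import Data.Nat.Properties
  open import Relation.Binary.PropositionalEquality
  open import Data.Nat.Solver using (module +-*-Solver)
  open +-*-Solver

  m M n : ℕ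
  m = suc k
  M = k * s + 1
  n = m * s + 1

  r₁ w₁ r₂ w₂ D numer denom : ℕ
  r₁ = k * s
  w₁ = k * M
  r₂ = k * (k * M + 1)
  w₂ = k * s
  D = k * m * M + k * s
  numer = (m * s) * (k * n + 1)
  denom = n * (k * m + 1) + k

  μ₁-total : r₁ + w₁ * m ≡ D
  μ₁-total = solve 2 (λ k s → k :* s :+ k :* (k :* s :+ con 1) :* (con 1 :+ k) := k :* (con 1 :+ k) :* (k :* s :+ con 1) :+ k :* s) refl k s

  μ₂-total : r₂ + w₂ * m ≡ D
  μ₂-total = solve 2 (λ k s → k :* (k :* (k :* s :+ con 1) :+ con 1) :+ k :* s :* (con 1 :+ k) := k :* (con 1 :+ k) :* (k :* s :+ con 1) :+ k :* s) refl k s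

  n∸s≡M : n ∸ s ≡ M
  n∸s≡M = trans (cong (_∸ s) (solve 2 (λ k s → (con 1 :+ k) :* s :+ con 1 := (k :* s :+ con 1) :+ s) refl k s)) (m+n∸n≡m M s)

  balanced : r₁ * M ≡ w₁ * s
  balanced = solve 2 (λ k s → k :* s :* (k :* s :+ con 1) := k :* (k :* s :+ con 1) :* s) refl k s

  column-value : numer * D ≡ w₁ * s * m * denom
  column-value = solve 2 (λ k s →
    ((con 1 :+ k) :* s) :* (k :* ((con 1 :+ k) :* s :+ con 1) :+ con 1) :* (k :* (con 1 :+ k) :* (k :* s :+ con 1) :+ k :* s)
    := (k :* (k :* s :+ con 1) :* s :* (con 1 :+ k)) :* (((con 1 :+ k) :* s :+ con 1) :* (k :* (con 1 :+ k) :+ con 1) :+ k)) refl k s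

  row-root-value : w₂ * M * m * denom ≡ numer * D
  row-root-value = solve 2 (λ k s →
    (k :* s :* (k :* s :+ con 1) :* (con 1 :+ k)) :* (((con 1 :+ k) :* s :+ con 1) :* (k :* (con 1 :+ k) :+ con 1) :+ k)
    := ((con 1 :+ k) :* s) :* (k :* ((con 1 :+ k) :* s :+ con 1) :+ con 1) :* (k :* (con 1 :+ k) :* (k :* s :+ con 1) :+ k :* s)) refl k s

  row-depth1-value : (r₂ * s + w₂ * s * m) * denom ≡ numer * D + w₂ * s * denom
  row-depth1-value = solve 2 (λ k s →
    (k :* (k :* (k :* s :+ con 1) :+ con 1) :* s :+ k :* s :* s :* (con 1 :+ k)) :* (((con 1 :+ k) :* s :+ con 1) :* (k :* (con 1 :+ k) :+ con 1) :+ k)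
    := ((con 1 :+ k) :* s) :* (k :* ((con 1 :+ k) :* s :+ con 1) :+ con 1) :* (k :* (con 1 :+ k) :* (k :* s :+ con 1) :+ k :* s)
       :+ k :* s :* s :* (((con 1 :+ k) :* s :+ con 1) :* (k :* (con 1 :+ k) :+ con 1) :+ k)) refl k s

  -- Below depth 1 the subtree sizes satisfy s = m s₂ + 1, and r₂ ≥ w₂ as soon as k ≥ 1.
  row-deep-value : 1 ≤ k → ∀ s₂ → s ≡ m * s₂ + 1 →
    (r₂ * s₂ + w₂ * s * m + w₂ * s₂) * denom ≤ numer * D + w₂ * s * denom
  row-deep-value 1≤k s₂ s≡ = begin
    (r₂ * s₂ + w₂ * s * m + w₂ * s₂) * denom
      ≡⟨ cong (_* denom) (solve 4 (λ a b c d → a :* d :+ b :+ c :* d := (a :* d :+ c :* d) :+ b) refl r₂ (w₂ * s * m) w₂ s₂) ⟩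
    (r₂ * s₂ + w₂ * s₂ + w₂ * s * m) * denom
      ≤⟨ *-monoˡ-≤ denom (+-monoˡ-≤ (w₂ * s * m) two-terms) ⟩
    (r₂ * s + w₂ * s * m) * denom
      ≡⟨ row-depth1-value ⟩
    numer * D + w₂ * s * denom ∎
    where
    open ≤-Reasoning
    x≤k*x : ∀ x → x ≤ k * x
    x≤k*x x = subst (_≤ k * x) (+-identityʳ x) (*-monoˡ-≤ x 1≤k)
    w₂≤r₂ : w₂ ≤ r₂
    w₂≤r₂ = *-monoʳ-≤ k (≤-trans (x≤k*x s) (≤-trans (m≤m+n (k * s) 1) (≤-trans (x≤k*x M) (m≤m+n (k * M) 1))))
    two-terms : r₂ * s₂ + w₂ * s₂ ≤ r₂ * s
    two-terms = begin
      r₂ * s₂ + w₂ * s₂            ≤⟨ +-monoʳ-≤ (r₂ * s₂) (*-monoˡ-≤ s₂ w₂≤r₂) ⟩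
      r₂ * s₂ + r₂ * s₂            ≤⟨ +-monoʳ-≤ (r₂ * s₂) (*-monoʳ-≤ r₂ (x≤k*x s₂)) ⟩
      r₂ * s₂ + r₂ * (k * s₂)      ≤⟨ m≤m+n _ r₂ ⟩
      r₂ * s₂ + r₂ * (k * s₂) + r₂ ≡⟨ solve 3 (λ a b c → a :* c :+ a :* (b :* c) :+ a := a :* ((con 1 :+ b) :* c :+ con 1)) refl r₂ k s₂ ⟩
      r₂ * (m * s₂ + 1)            ≡⟨ cong (r₂ *_) (sym s≡) ⟩
      r₂ * s                       ∎


module SafetyValue (k′ h′ : Data.Nat.ℕ) where

  open import Defs
  open import Data.Nat using (ℕ; zero; suc; _+_; _*_; _∸_; _^_; _≤_; z≤n; s≤s)
  open import Data.Nat.Properties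
  open import Data.Nat.DivMod using (_/_; m*n/n≡m)
  import Data.Rational as ℚ
  import Data.Rational.Properties as ℚP
  open import Data.Fin using (Fin; toℕ)
  open import Data.Product using (_,_)
  open import Relation.Binary.PropositionalEquality
  open import Data.Nat.Solver using (module +-*-Solver)
  open +-*-Solver using (solve; _:+_; _:*_; _:=_; con)
  open FiniteSums
  open Fractions
  open MixedStrategies using (module ℚΣ; ΣFin≡sum; sum-/1+; sum-/1+-*-fromℕ; sum-fromℕ-*-/1+; gain-≥-byColumns; gain-≤-byRows)

  k h : ℕ
  k = suc k′
  h = suc h′

  open HeapTree k h
  open TreeGains k h using (A)
  open StrategyBounds k h′
  open Arithmetic k s hiding (m) renaming (n to n′)

  m^h≡M : m ^ h ≡ M
  m^h≡M = m^≡k*sumBelow+1 h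

  n≡n′ : n ≡ n′
  n≡n′ = nodes≡m*sumBelow+1 h

  D₋ denom₋ : ℕ
  D₋ = D ∸ 1
  denom₋ = denom ∸ 1

  D≡suc : D ≡ suc D₋
  D≡suc = sym (m+[n∸m]≡n (≤-trans (*-mono-≤ {1} {k * m} {1} {M} (*-mono-≤ {1} {k} {1} {m} (s≤s z≤n) (s≤s z≤n)) (m≤n+m 1 (k * s)))
                                   (m≤m+n (k * m * M) (k * s))))

  denom≡suc : denom ≡ suc denom₋
  denom≡suc = sym (m+[n∸m]≡n (≤-trans (s≤s z≤n) (m≤n+m k _)))

  frac-suc : ∀ a {x d} → x ≡ suc d → frac a x ≡ a /1+ d
  frac-suc a refl = refl

  Dval≡D : Dval m h ≡ D
  Dval≡D = begin
    ((m ^ (h + 2) ∸ m ^ (h + 1)) + m ^ h) ∸ 1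
      ≡⟨ cong₂ (λ x y → ((x ∸ y) + m ^ h) ∸ 1) (cong (m ^_) (+-comm h 2)) (cong (m ^_) (+-comm h 1)) ⟩
    ((m * (m * m ^ h) ∸ m * m ^ h) + m ^ h) ∸ 1  ≡⟨ cong (λ x → ((m * (m * x) ∸ m * x) + x) ∸ 1) m^h≡M ⟩
    ((m * (m * M) ∸ m * M) + M) ∸ 1              ≡⟨ cong (λ x → (x + M) ∸ 1) (m+n∸m≡n (m * M) (k * (m * M))) ⟩
    (k * (m * M) + (k * s + 1)) ∸ 1              ≡⟨ cong (_∸ 1) (sym (+-assoc (k * (m * M)) (k * s) 1)) ⟩
    (k * (m * M) + k * s + 1) ∸ 1                ≡⟨ m+n∸n≡m _ 1 ⟩
    k * (m * M) + k * s                          ≡⟨ cong (_+ k * s) (sym (*-assoc k m M)) ⟩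
    D                                            ∎
    where open ≡-Reasoning

  value≡ : valueFormula m h ≡ numer /1+ denom₋
  value≡ = trans (frac-suc _ (trans denominator denom≡suc)) (cong (_/1+ denom₋) numerator)
    where
    open ≡-Reasoning
    denominator : (n * ((m * m ∸ m) + 1) + m) ∸ 1 ≡ denom
    denominator = begin
      (n * ((m * m ∸ m) + 1) + m) ∸ 1  ≡⟨ cong (λ x → (n * (x + 1) + m) ∸ 1) (m+n∸m≡n m (k * m)) ⟩
      (n * (k * m + 1) + suc k) ∸ 1    ≡⟨ cong (_∸ 1) (+-suc (n * (k * m + 1)) k) ⟩
      n * (k * m + 1) + k              ≡⟨ cong (λ x → x * (k * m + 1) + k) n≡n′ ⟩
      denom                            ∎
    numerator : (n ∸ 1) * ((m ∸ 1) * n + 1) ≡ numer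
    numerator = begin
      (n ∸ 1) * (k * n + 1)             ≡⟨ cong (λ x → (x ∸ 1) * (k * x + 1)) n≡n′ ⟩
      (m * s + 1 ∸ 1) * (k * n′ + 1)    ≡⟨ cong (_* (k * n′ + 1)) (m+n∸n≡m (m * s) 1) ⟩
      numer                             ∎

  m^h∸1≡ks : m ^ h ∸ 1 ≡ k * s
  m^h∸1≡ks = trans (cong (_∸ 1) m^h≡M) (m+n∸n≡m (k * s) 1)

  byDepth-/1+ : ∀ a b d v → byDepth m h (a /1+ d) (b /1+ d) v ≡ byDepthℕ a b (toℕ v) /1+ d
  byDepth-/1+ a b d v with depth m (toℕ v)
  ... | zero = refl
  ... | suc zero = refl
  ... | suc (suc _) = sym (0/1+ d)

  Dval≡suc : Dval m h ≡ suc D₋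
  Dval≡suc = trans Dval≡D D≡suc

  μ₁≡ : ∀ v → μ₁ m h v ≡ byDepthℕ r₁ w₁ (toℕ v) /1+ D₋
  μ₁≡ v = trans (cong₂ (λ x y → byDepth m h x y v)
                       (trans (frac-suc _ Dval≡suc) (cong (_/1+ D₋) m^h∸1≡ks))
                       (trans (frac-suc _ Dval≡suc) (cong (λ z → (k * z) /1+ D₋) m^h≡M)))
                (byDepth-/1+ r₁ w₁ D₋ v)

  μ₂≡ : ∀ v → μ₂ m h v ≡ byDepthℕ r₂ w₂ (toℕ v) /1+ D₋
  μ₂≡ v = trans (cong₂ (λ x y → byDepth m h x y v)
                       (trans (frac-suc _ Dval≡suc) (cong (λ z → (k * (z + 1)) /1+ D₋) m^[h+1]∸m^h))
                       (trans (frac-suc _ Dval≡suc) (cong (_/1+ D₋) m^h∸1≡ks)))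
                (byDepth-/1+ r₂ w₂ D₋ v)
    where
    m^[h+1]∸m^h : m ^ (h + 1) ∸ m ^ h ≡ k * M
    m^[h+1]∸m^h = trans (cong₂ _∸_ (trans (cong (m ^_) (+-comm h 1)) (cong (m *_) m^h≡M)) m^h≡M) (m+n∸m≡n M (k * M))

  byDepth-mixed : ∀ (X : Fin n → ℚ.ℚ) r w → (∀ v → X v ≡ byDepthℕ r w (toℕ v) /1+ D₋) → r + w * m ≡ D → IsMixed X
  byDepth-mixed X r w X≡ total = (λ v → subst (ℚ.0ℚ ℚ.≤_) (sym (X≡ v)) (0≤/1+ (byDepthℕ r w (toℕ v)) D₋)) , (begin
    ΣFin X                                          ≡⟨ ΣFin≡sum X ⟩
    ℚΣ.sum {n} X                                    ≡⟨ ℚΣ.sum-cong-≗ {n} X≡ ⟩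
    ℚΣ.sum {n} (λ v → byDepthℕ r w (toℕ v) /1+ D₋)  ≡⟨ sum-/1+ {n} (λ v → byDepthℕ r w (toℕ v)) D₋ ⟩
    sum {n} (λ v → byDepthℕ r w (toℕ v)) /1+ D₋     ≡⟨ cong (_/1+ D₋) (trans (sum-byDepthℕ r w) (trans total D≡suc)) ⟩
    suc D₋ /1+ D₋                                   ≡⟨ /1+-self D₋ ⟩
    ℚ.1ℚ                                            ∎)
    where open ≡-Reasoning

  μ₁-mixed : IsMixed (μ₁ m h)
  μ₁-mixed = byDepth-mixed (μ₁ m h) r₁ w₁ μ₁≡ μ₁-total

  μ₂-mixed : IsMixed (μ₂ m h)
  μ₂-mixed = byDepth-mixed (μ₂ m h) r₂ w₂ μ₂≡ μ₂-total

  nodes∸s≡M : n ∸ s ≡ M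
  nodes∸s≡M = trans (cong (_∸ s) n≡n′) n∸s≡M

  column-≥-value : ∀ j → numer /1+ denom₋ ℚ.≤ ℚΣ.sum (λ i → μ₁ m h i ℚ.* fromℕ (A i j))
  column-≥-value j =
    subst (numer /1+ denom₋ ℚ.≤_)
      (sym (trans (ℚΣ.sum-cong-≗ {n} (λ i → cong (ℚ._* fromℕ (A i j)) (μ₁≡ i)))
                  (sum-/1+-*-fromℕ (λ i → byDepthℕ r₁ w₁ (toℕ i)) (λ i → A i j) D₋)))
      (/1+-≤ numer denom₋ K D₋ (begin
        numer * suc D₋      ≡⟨ cong (numer *_) (sym D≡suc) ⟩
        numer * D           ≡⟨ column-value ⟩
        w₁ * s * m * denom  ≤⟨ *-monoˡ-≤ denom (Columns.column-≥ r₁ w₁ (trans (cong (r₁ *_) nodes∸s≡M) balanced) j) ⟩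
        K * denom           ≡⟨ cong (K *_) denom≡suc ⟩
        K * suc denom₋      ∎))
    where
    open ≤-Reasoning
    K = sum {n} (λ i → Columns.weighted r₁ w₁ i j)

  private
    cancel-w₂s : ∀ K X → K + w₂ * s ≤ X → X * denom ≤ numer * D + w₂ * s * denom → K * denom ≤ numer * D
    cancel-w₂s K X K+w₂s≤X X≤ = +-cancelʳ-≤ (w₂ * s * denom) _ _ (begin
      K * denom + w₂ * s * denom  ≡⟨ sym (*-distribʳ-+ denom K (w₂ * s)) ⟩
      (K + w₂ * s) * denom        ≤⟨ *-monoˡ-≤ denom K+w₂s≤X ⟩
      X * denom                   ≤⟨ X≤ ⟩
      numer * D + w₂ * s * denom  ∎)
      where open ≤-Reasoning

  row-≤ : ∀ i → sum {n} (Rows.weighted r₂ w₂ i) * denom ≤ numer * D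
  row-≤ i with depthOf (toℕ i)
  ... | root i≡0 = ≤-trans (*-monoˡ-≤ denom (Rows.row-root r₂ w₂ i i≡0))
                           (≤-reflexive (trans (cong (λ z → w₂ * z * m * denom) nodes∸s≡M) row-root-value))
  ... | depth1 1≤i i<nodes1 = cancel-w₂s _ _ (Rows.row-depth1 r₂ w₂ i 1≤i i<nodes1) (≤-reflexive row-depth1-value)
  ... | deep nodes1≤i = cancel-w₂s _ _ (Rows.row-deep r₂ w₂ i nodes1≤i)
          (row-deep-value (s≤s z≤n) s₂ (trans (sym (nodes≡sumBelow h′)) (nodes≡m*sumBelow+1 h′)))

  row-≤-value : ∀ i → ℚΣ.sum (λ j → fromℕ (A i j) ℚ.* μ₂ m h j) ℚ.≤ numer /1+ denom₋
  row-≤-value i =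
    subst (ℚ._≤ numer /1+ denom₋)
      (sym (trans (ℚΣ.sum-cong-≗ {n} (λ j → cong (fromℕ (A i j) ℚ.*_) (μ₂≡ j)))
                  (sum-fromℕ-*-/1+ (λ j → A i j) (λ j → byDepthℕ r₂ w₂ (toℕ j)) D₋)))
      (/1+-≤ K D₋ numer denom₋ (subst₂ _≤_ (cong (K *_) denom≡suc) (cong (numer *_) D≡suc) (row-≤ i)))
    where K = sum {n} (Rows.weighted r₂ w₂ i)

  μ₁-guarantees : (Y : Fin n → ℚ.ℚ) → IsMixed Y → valueFormula m h ℚ.≤ expGain (T m h) (μ₁ m h) Y
  μ₁-guarantees Y Y-mixed = subst (ℚ._≤ expGain (T m h) (μ₁ m h) Y) (sym value≡)
    (gain-≥-byColumns (μ₁ m h) Y A (numer /1+ denom₋) column-≥-value Y-mixed)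

  μ₂-caps : (X : Fin n → ℚ.ℚ) → IsMixed X → expGain (T m h) X (μ₂ m h) ℚ.≤ valueFormula m h
  μ₂-caps X X-mixed = subst (expGain (T m h) X (μ₂ m h) ℚ.≤_) (sym value≡)
    (gain-≤-byRows X (μ₂ m h) A (numer /1+ denom₋) row-≤-value X-mixed)

  value-attained : expGain (T m h) (μ₁ m h) (μ₂ m h) ≡ valueFormula m h
  value-attained = ℚP.≤-antisym (μ₂-caps (μ₁ m h) μ₁-mixed) (μ₁-guarantees (μ₂ m h) μ₂-mixed)

  size≡ : size (T m h) ≡ divℕ (m ^ (h + 1) ∸ 1) (m ∸ 1)
  size≡ = begin
    n                        ≡⟨ n≡n′ ⟩
    n′                       ≡⟨ sym (m*n/n≡m n′ k) ⟩
    n′ * k / k               ≡⟨ cong (_/ k) (*-comm n′ k) ⟩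
    k * n′ / k               ≡⟨ cong (_/ k) (sym (m+n∸n≡m (k * n′) 1)) ⟩
    (k * n′ + 1 ∸ 1) / k     ≡⟨ cong (λ z → (z ∸ 1) / k) (sym m*M≡k*n′+1) ⟩
    (m * M ∸ 1) / k          ≡⟨ cong (λ z → (m * z ∸ 1) / k) (sym m^h≡M) ⟩
    (m * m ^ h ∸ 1) / k      ≡⟨ cong (λ z → (m ^ z ∸ 1) / k) (+-comm 1 h) ⟩
    (m ^ (h + 1) ∸ 1) / k    ∎
    where
    open ≡-Reasoning
    m*M≡k*n′+1 : m * M ≡ k * n′ + 1
    m*M≡k*n′+1 = solve 2 (λ k s → (con 1 :+ k) :* (k :* s :+ con 1) := k :* ((con 1 :+ k) :* s :+ con 1) :+ con 1) refl k s


open import Defs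
open import Data.Nat using (ℕ; _≤_; zero; suc; s≤s)
open import Data.Rational using (ℚ; _≤_)
open import Data.Fin using (Fin)
open import Data.Product using (_×_; _,_)
open import Relation.Binary.PropositionalEquality using (_≡_)

mainTheorem4 :
    (m h : ℕ) → 2 Data.Nat.≤ m → 1 Data.Nat.≤ h →
      (size (T m h) ≡ divℕ (m Data.Nat.^ (h Data.Nat.+ 1) Data.Nat.∸ 1) (m Data.Nat.∸ 1))
      × IsMixed (μ₁ m h) × IsMixed (μ₂ m h)
      × ((Y : Fin (size (T m h)) → ℚ) → IsMixed Y →
           valueFormula m h Data.Rational.≤ expGain (T m h) (μ₁ m h) Y)
      × ((X : Fin (size (T m h)) → ℚ) → IsMixed X →
           expGain (T m h) X (μ₂ m h) Data.Rational.≤ valueFormula m h)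
      × expGain (T m h) (μ₁ m h) (μ₂ m h) ≡ valueFormula m h
mainTheorem4 (suc (suc k′)) (suc h′) _ _ = size≡ , μ₁-mixed , μ₂-mixed , μ₁-guarantees , μ₂-caps , value-attained
  where open SafetyValue k′ h′
mainTheorem4 (suc (suc k′)) zero _ ()
mainTheorem4 (suc zero) _ (s≤s ()) _
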